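{- Let $k\ge 3$ be an odd integer. If $H\in M_{0,1,\ldots,k-1}$ (as described in the context), then $H$ has a Fulkerson-cover, i.e. there exist six perfect matchings of $H$ such that every edge of $H$ belongs to exactly two of them.
   Context: All graphs are finite and simple. A Fulkerson-cover of a cubic graph is a collection of six perfect matchings such that each edge lies in exactly two of them. A cubic graph is cyclically $4$-edge-connected if at least $4$ edges must be removed to disconnect it into two components each containing a circuit. The family $M_{0,1,\ldots,k-1}$ ($k\ge 2$). Let $G_0,\ldots,G_{k-1}$ be cyclically $4$-edge-connected bridgeless cubic graphs, each having a Fulkerson-cover. In each $G_i$ choose an edge $x_iy_i$; let $x_i^0,x_i^1$ be the two neighbours of $x_i$ other than $y_i$, and $y_i^0,y_i^1$ the two neighbours of $y_i$ other than $x_i$. Let $H_i=G_i\setminus\{x_i,y_i\}$. For $k=2$, $\{G;G_0,G_1\}$ is obtained from the disjoint union of $H_0,H_1$ by adding vertices $a_0,b_0,c_0,a_1,b_1,c_1$ and the 13 edges $a_0y_0^0, a_0x_1^0, a_0c_0, c_0b_0, b_0y_0^1, b_0x_1^1, b_1x_0^1, b_1y_1^1, b_1c_1, c_1a_1, a_1x_0^0, a_1y_1^0, c_0c_1$. For $3\le i\le k$, $\{G;G_0,\ldots,G_{i-1}\}$ is obtained from $\{G;G_0,\ldots,G_{i-2}\}$ as follows: add a copy of $H_{i-1}$ and new vertices $a_{i-1},b_{i-1},c_{i-1}$; subdivide by a new vertex $v_{i-3}$ the unique edge $e_0$ incident with $c_0$ that is not in any $H_j$ and is not one of $a_jc_j,c_jb_j$;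 delete the edges $a_{i-2}x_0^0$ and $b_{i-2}x_0^1$ and add the edges $a_{i-2}x_{i-1}^0$, $b_{i-2}x_{i-1}^1$, $a_{i-1}x_0^0$, $a_{i-1}y_{i-1}^0$, $b_{i-1}x_0^1$, $b_{i-1}y_{i-1}^1$, $c_{i-1}a_{i-1}$, $c_{i-1}b_{i-1}$, $c_{i-1}v_{i-3}$; all other edges remain the same. Equivalently, $\{G;G_0,\ldots,G_{k-1}\}$ consists of $H_0,\ldots,H_{k-1}$, vertices $a_i,b_i,c_i$ ($0\le i\le k-1$) and $v_0,\ldots,v_{k-3}$, with edges $a_ic_i$, $b_ic_i$, $a_iy_i^0$, $a_ix_{i+1}^0$, $b_iy_i^1$, $b_ix_{i+1}^1$ (indices mod $k$), the path $c_0v_{k-3}v_{k-4}\cdots v_0c_1$ (the single edge $c_0c_1$ if $k=2$), and the edges $c_iv_{i-2}$ for $2\le i\le k-1$. The family of all graphs so obtained (over all choices of the $G_i$ and edges $x_iy_i$) is $M_{0,1,\ldots,k-1}$. -}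

module Defs where

open import Data.Nat using (ℕ; zero; suc; _+_; _∸_; _≤_; _<ᵇ_)
open import Data.Nat.Base using (_≡ᵇ_)
open import Data.Fin using (Fin; zero; suc; toℕ; inject₁; fromℕ; punchIn; splitAt)
open import Data.Fin.Properties using (_≟_)
open import Data.Bool using (Bool; true; false; _∧_; _∨_; not; if_then_else_)
open import Data.Product using (Σ; _×_; _,_; proj₁; proj₂)
open import Data.Sum using (_⊎_; inj₁; inj₂)
open import Function using (_∘_)
open import Relation.Nullary using (¬_; yes; no)
open import Relation.Nullary.Decidable using (⌊_⌋)
open import Relation.Binary.PropositionalEquality using (_≡_; _≢_; refl)

countB : ∀ {n} → (Fin n → Bool) → ℕ
countB {zero}  f = 0
countB {suc n} f = (if f zero then 1 else 0) + countB (f ∘ suc)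

sumN : ∀ {n} → (Fin n → ℕ) → ℕ
sumN {zero}  f = 0
sumN {suc n} f = f zero + sumN (f ∘ suc)

Graph : ℕ → Set
Graph n = Fin n → Fin n → Bool

IsSimple : ∀ {n} → Graph n → Set
IsSimple {n} G = (∀ (u v : Fin n) → G u v ≡ G v u) × (∀ (v : Fin n) → G v v ≡ false)

degree : ∀ {n} → Graph n → Fin n → ℕ
degree G v = countB (G v)

IsCubic : ∀ {n} → Graph n → Set
IsCubic {n} G = ∀ (v : Fin n) → degree G v ≡ 3

data ReachWithout {n} (G : Graph n) (a b : Fin n) : Fin n → Fin n → Set where
  here : ∀ {u} → ReachWithout G a b u u
  step : ∀ {u w v} → G u w ≡ true → ¬ (u ≡ a × w ≡ b) → ¬ (u ≡ b × w ≡ a) →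
         ReachWithout G a b w v → ReachWithout G a b u v

IsBridge : ∀ {n} → Graph n → Fin n → Fin n → Set
IsBridge G a b = (G a b ≡ true) × ¬ ReachWithout G a b a b

Bridgeless : ∀ {n} → Graph n → Set
Bridgeless {n} G = ∀ (a b : Fin n) → ¬ IsBridge G a b

record CircuitIn {n} (G : Graph n) (S : Fin n → Bool) : Set where
  field
    len    : ℕ
    vs     : Fin (3 + len) → Fin n
    inj    : ∀ i j → vs i ≡ vs j → i ≡ j
    inS    : ∀ i → S (vs i) ≡ true
    consec : ∀ (i : Fin (2 + len)) → G (vs (inject₁ i)) (vs (suc i)) ≡ true
    close  : G (vs (fromℕ (2 + len))) (vs zero) ≡ true

cutSize : ∀ {n} → Graph n → (Fin n → Bool) → ℕ
cutSize G S = sumN (λ u → if S u then countB (λ v → not (S v) ∧ G u v) else 0)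

Cyclically4EC : ∀ {n} → Graph n → Set
Cyclically4EC {n} G =
  ∀ (S : Fin n → Bool) → CircuitIn G S → CircuitIn G (not ∘ S) → 4 ≤ cutSize G S

record PerfectMatching {n} (G : Graph n) : Set where
  field
    M       : Graph n
    sym     : ∀ u v → M u v ≡ M v u
    sub     : ∀ u v → M u v ≡ true → G u v ≡ true
    perfect : ∀ v → countB (M v) ≡ 1

-- six perfect matchings (not necessarily distinct) covering every edge exactly twice
FulkersonCover : ∀ {n} → Graph n → Set
FulkersonCover {n} G =
  Σ (Fin 6 → PerfectMatching G) λ F →
    ∀ (u v : Fin n) → G u v ≡ true →
      countB (λ i → PerfectMatching.M (F i) u v) ≡ 2

record Piece : Set where
  field
    m  : ℕ                -- G has 2 + m vertices; H = G - {x,y} has m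
    G  : Graph (2 + m)
    x y x0 x1 y0 y1 : Fin (2 + m)

record ValidPiece (P : Piece) : Set where
  open Piece P
  field
    simple    : IsSimple G
    cubic     : IsCubic G
    bridgeless : Bridgeless G
    cyc4      : Cyclically4EC G
    fulkerson : FulkersonCover G
    xy        : G x y ≡ true
    xx0       : G x x0 ≡ true
    xx1       : G x x1 ≡ true
    x0≢x1     : x0 ≢ x1
    x0≢y      : x0 ≢ y
    x1≢y      : x1 ≢ y
    yy0       : G y y0 ≡ true
    yy1       : G y y1 ≡ true
    y0≢y1     : y0 ≢ y1
    y0≢x      : y0 ≢ x
    y1≢x      : y1 ≢ x

-- dropAt i j = j if j < i, j - 1 if j > i  (value for j = i irrelevant)
dropAt : ∀ {m} → Fin (2 + m) → Fin (2 + m) → Fin (1 + m)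
dropAt zero    zero    = zero
dropAt zero    (suc j) = j
dropAt (suc i) zero    = zero
dropAt {zero}  (suc i) (suc j) = zero
dropAt {suc m} (suc i) (suc j) = suc (dropAt i j)

-- for x ≢ y, embH x y : Fin m → Fin (2 + m) is the increasing bijection
-- onto Fin (2 + m) ∖ {x , y}; it identifies V(H) with V(G) ∖ {x , y}
embH : ∀ {m} → Fin (2 + m) → Fin (2 + m) → Fin m → Fin (2 + m)
embH x y j = punchIn x (punchIn (dropAt x y) j)

data Vtx (k : ℕ) (P : Fin k → Piece) : Set where
  hv : (i : Fin k) → Fin (Piece.m (P i)) → Vtx k P
  av bv cv : Fin k → Vtx k P
  vv : Fin (k ∸ 2) → Vtx k P

_==F_ : ∀ {n} → Fin n → Fin n → Bool
i ==F j = ⌊ i ≟ j ⌋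

isNext : ∀ {k} → Fin k → Fin k → Bool
isNext {k} i j = (toℕ j ≡ᵇ suc (toℕ i)) ∨ ((toℕ j ≡ᵇ 0) ∧ (suc (toℕ i) ≡ᵇ k))

module Construction (k : ℕ) (P : Fin k → Piece) where
  open Piece

  embP : (i : Fin k) → Fin (m (P i)) → Fin (2 + m (P i))
  embP i = embH (x (P i)) (y (P i))

  -- the listed edges, each in one orientation
  E : Vtx k P → Vtx k P → Bool
  E (hv i j) (hv i' j') with i ≟ i'
  ... | yes refl = G (P i) (embP i j) (embP i j')
  ... | no _     = false
  E (av i) (cv i') = i ==F i'
  E (bv i) (cv i') = i ==F i'
  E (av i) (hv i' j) =
    ((i ==F i') ∧ (embP i' j ==F y0 (P i'))) ∨ (isNext i i' ∧ (embP i' j ==F x0 (P i')))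
  E (bv i) (hv i' j) =
    ((i ==F i') ∧ (embP i' j ==F y1 (P i'))) ∨ (isNext i i' ∧ (embP i' j ==F x1 (P i')))
  -- path c_0 v_{k-3} ... v_0 c_1 , and c_i v_{i-2} (2 ≤ i ≤ k-1)
  E (cv i) (vv j) =
    ((toℕ i ≡ᵇ 0) ∧ (toℕ j + 3 ≡ᵇ k))
    ∨ ((toℕ i ≡ᵇ 1) ∧ (toℕ j ≡ᵇ 0))
    ∨ (toℕ i ≡ᵇ toℕ j + 2)
  E (vv j) (vv j') = suc (toℕ j) ≡ᵇ toℕ j'
  E _ _ = false

  adjV : Vtx k P → Vtx k P → Bool
  adjV u v = E u v ∨ E v u

  nH : ℕ
  nH = sumN (λ i → m (P i))

  N : ℕ
  N = nH + (k + (k + (k + (k ∸ 2))))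

  decodeΣ : ∀ {l} (ms : Fin l → ℕ) → Fin (sumN ms) → Σ (Fin l) (Fin ∘ ms)
  decodeΣ {suc l} ms j with splitAt (ms zero) j
  ... | inj₁ a = zero , a
  ... | inj₂ b = suc (proj₁ (decodeΣ (ms ∘ suc) b)) , proj₂ (decodeΣ (ms ∘ suc) b)

  decode : Fin N → Vtx k P
  decode u with splitAt nH u
  ... | inj₁ h = hv (proj₁ (decodeΣ (λ i → m (P i)) h)) (proj₂ (decodeΣ (λ i → m (P i)) h))
  ... | inj₂ r with splitAt k r
  ...   | inj₁ i = av i
  ...   | inj₂ r₁ with splitAt k r₁
  ...     | inj₁ i = bv i
  ...     | inj₂ r₂ with splitAt k r₂
  ...       | inj₁ i = cv i
  ...       | inj₂ j = vv j

  graph : Graph N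
  graph u v = adjV (decode u) (decode v)

MGraph : (k : ℕ) (P : Fin k → Piece) → Graph (Construction.N k P)
MGraph k P = Construction.graph k P

-- Fix a Fulkerson cover of every G_i.  Two of its matchings contain x_i y_i; the other four
-- use each remaining edge at x_i and at y_i twice, so they form two complementary pairs.
-- The six matchings of H are built in rounds t = 0, ..., 5: in round t each G_i contributes
-- one of its matchings with x_i, y_i deleted, the edges it had at x_i (y_i) being redirected
-- to a_{i-1}, b_{i-1} (a_i, b_i).  At the junction a_i b_i c_i this yields a matching when
-- either exactly one of the two contributed matchings passes through its edge x y (then c_i
-- takes whichever of a_i, b_i is left), or neither does and they claim different vertices
-- among a_i, b_i (then c_i is matched inside the spine, the tree on the c's and v's).  The
-- spine has three matchings, absorbing {c_i | i ≥ 2}, {c_1} and {c_0} and together covering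
-- each spine edge once; each is used in two rounds.  The matchings through x_i y_i are used
-- in rounds 2,3 for G_0, in rounds 0,1 for G_1 and alternately in rounds 4,5 and 2,3 for
-- G_2, ..., G_{k-1}; since k is odd this alternation closes up around the cycle.  Finally
-- the complementary pairs are oriented one G_i after another so that the claims at the
-- spine junctions differ.
module Submission where

open import Defs
open import Data.Nat using (ℕ; zero; suc; _+_; _∸_; _≤_; _%_; _≡ᵇ_; s≤s; z≤n; pred)
open import Data.Nat.DivMod using ([m+n]%n≡m%n; %-congˡ)
open import Data.Nat.Properties
  using (+-suc; +-comm; suc-injective; ≤-pred; ≤∧≢⇒<; ≤-refl; ≤-trans; n≤1+n; 1+n≰n; pred[n]≤n)
open import Data.Fin using (Fin; zero; suc; #_; toℕ; fromℕ; _↑ˡ_; _↑ʳ_; splitAt; punchIn; punchOut)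
open import Data.Fin.Properties
  using (_≟_; toℕ-injective; toℕ<n; toℕ-fromℕ; punchIn-injective; punchInᵢ≢i; punchIn-punchOut;
         splitAt-↑ˡ; splitAt-↑ʳ; splitAt⁻¹-↑ˡ; splitAt⁻¹-↑ʳ)
  renaming (suc-injective to Fin-suc-injective)
open import Data.Bool using (Bool; true; false; _∧_; _∨_; _xor_; not; if_then_else_)
open import Data.Bool.Properties
  using (∧-identityʳ; ∨-zeroʳ; ∧-conicalˡ; ∧-conicalʳ; not-involutive; not-injective; T?)
open import Data.List using (List; []; _∷_; filter)
import Data.Vec.Functional as Table
open import Data.Product using (Σ; _×_; _,_; proj₁; proj₂)
open import Data.Sum using (_⊎_; inj₁; inj₂)
open import Data.Empty using (⊥-elim)
open import Function using (_∘_)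
open import Relation.Nullary using (¬_; yes; no; Dec)
open import Relation.Nullary.Decidable using (⌊_⌋)
open import Relation.Binary.PropositionalEquality

indicator : Bool → ℕ
indicator b = if b then 1 else 0

true≢false : true ≢ false
true≢false ()

∧-intro : ∀ {a b} → a ≡ true → b ≡ true → (a ∧ b) ≡ true
∧-intro refl refl = refl

⌊⌋-⇔ : ∀ {A B : Set} (a : Dec A) (b : Dec B) → (A → B) → (B → A) → ⌊ a ⌋ ≡ ⌊ b ⌋
⌊⌋-⇔ (yes _) (yes _) f g = refl
⌊⌋-⇔ (yes x) (no y)  f g = ⊥-elim (y (f x))
⌊⌋-⇔ (no x)  (yes y) f g = ⊥-elim (x (g y))
⌊⌋-⇔ (no _)  (no _)  f g = refl

==F-refl : ∀ {n} (j : Fin n) → (j ==F j) ≡ true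
==F-refl j with j ≟ j
... | yes _ = refl
... | no ne = ⊥-elim (ne refl)

==F-sound : ∀ {n} (j j' : Fin n) → (j ==F j') ≡ true → j ≡ j'
==F-sound j j' e with j ≟ j'
... | yes p = p

==F-complete : ∀ {n} {j j' : Fin n} → j ≡ j' → (j ==F j') ≡ true
==F-complete refl = ==F-refl _

==F-false : ∀ {n} (j j' : Fin n) → j ≢ j' → (j ==F j') ≡ false
==F-false j j' ne with j ≟ j'
... | yes p = ⊥-elim (ne p)
... | no _  = refl

_≠_ : ∀ {n} → Fin n → Fin n → Bool
v ≠ w = not (v ==F w)

≢⇒≠ : ∀ {n} {v w : Fin n} → v ≢ w → (v ≠ w) ≡ true
≢⇒≠ ne = cong not (==F-false _ _ ne)

≡ᵇ-sound : ∀ a b → (a ≡ᵇ b) ≡ true → a ≡ b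
≡ᵇ-sound zero    zero    _ = refl
≡ᵇ-sound (suc a) (suc b) e = cong suc (≡ᵇ-sound a b e)

≡ᵇ-refl : ∀ a → (a ≡ᵇ a) ≡ true
≡ᵇ-refl zero    = refl
≡ᵇ-refl (suc a) = ≡ᵇ-refl a

≡ᵇ-complete : ∀ {a b} → a ≡ b → (a ≡ᵇ b) ≡ true
≡ᵇ-complete {a} refl = ≡ᵇ-refl a

≡ᵇ-false : ∀ {a b} → a ≢ b → (a ≡ᵇ b) ≡ false
≡ᵇ-false {a} {b} ne with a ≡ᵇ b in e
... | true  = ⊥-elim (ne (≡ᵇ-sound a b e))
... | false = refl

∨-introˡ : ∀ {a b} → a ≡ true → (a ∨ b) ≡ true
∨-introˡ refl = refl

∨-introʳ : ∀ a {b} → b ≡ true → (a ∨ b) ≡ true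
∨-introʳ true  _ = refl
∨-introʳ false e = e

∨-resolveˡ : ∀ a {b} → (a ∨ b) ≡ true → b ≡ false → a ≡ true
∨-resolveˡ true  _    _  = refl
∨-resolveˡ false refl ()

suc-pred-≢0 : ∀ {q} → q ≢ 0 → suc (pred q) ≡ q
suc-pred-≢0 {zero}  h = ⊥-elim (h refl)
suc-pred-≢0 {suc q} _ = refl

Bool-⇔⇒≡ : ∀ {a b} → (a ≡ true → b ≡ true) → (b ≡ true → a ≡ true) → a ≡ b
Bool-⇔⇒≡ {true}  {true}  f g = refl
Bool-⇔⇒≡ {false} {false} f g = refl
Bool-⇔⇒≡ {true}  {false} f g = sym (f refl)
Bool-⇔⇒≡ {false} {true}  f g = g refl

countB-cong : ∀ {n} {f g : Fin n → Bool} → (∀ i → f i ≡ g i) → countB f ≡ countB g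
countB-cong {zero}          h = refl
countB-cong {suc n} {f} {g} h rewrite h zero =
  cong (indicator (g zero) +_) (countB-cong (h ∘ suc))

countB-none : ∀ {n} {f : Fin n → Bool} → (∀ i → f i ≡ false) → countB f ≡ 0
countB-none {zero}      h = refl
countB-none {suc n} {f} h rewrite h zero = countB-none (h ∘ suc)

countB≡0⇒false : ∀ {n} {f : Fin n → Bool} → countB f ≡ 0 → ∀ i → f i ≡ false
countB≡0⇒false {suc n} {f} e i with f zero in eq
countB≡0⇒false {suc n} {f} () i       | true
countB≡0⇒false {suc n} {f} e zero    | false = eq
countB≡0⇒false {suc n} {f} e (suc i) | false = countB≡0⇒false e i

countB≡suc⇒witness : ∀ {n c} {f : Fin n → Bool} → countB f ≡ suc c → Σ (Fin n) (λ w → f w ≡ true)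
countB≡suc⇒witness {suc n} {c} {f} e with f zero in eq
... | true  = zero , eq
... | false = let (w , p) = countB≡suc⇒witness {n} {c} {f ∘ suc} e in suc w , p

true⇒countB≢0 : ∀ {n} {f : Fin n → Bool} (w : Fin n) → f w ≡ true → countB f ≢ 0
true⇒countB≢0 w p e = true≢false (trans (sym p) (countB≡0⇒false e w))

countB-remove : ∀ {n} (f : Fin n → Bool) (w : Fin n) → f w ≡ true →
  countB f ≡ suc (countB (λ v → f v ∧ (v ≠ w)))
countB-remove {suc n} f zero p rewrite p =
  cong suc (countB-cong (λ v → sym (∧-identityʳ (f (suc v)))))
countB-remove {suc n} f (suc w) p rewrite countB-remove (f ∘ suc) w p | ∧-identityʳ (f zero) =
  trans (+-suc (indicator (f zero)) _)
    (cong (λ z → suc (indicator (f zero) + z)) (countB-cong (λ v → cong (λ z → f (suc v) ∧ not z)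
      (⌊⌋-⇔ (v ≟ w) (suc v ≟ suc w) (cong suc) Fin-suc-injective))))

countB≡1-intro : ∀ {n} (f : Fin n → Bool) (w : Fin n) → f w ≡ true →
  (∀ v → f v ≡ true → v ≡ w) → countB f ≡ 1
countB≡1-intro f w p unique rewrite countB-remove f w p = cong suc (countB-none others)
  where
  others : ∀ v → (f v ∧ (v ≠ w)) ≡ false
  others v with f v in fv | v ≟ w
  ... | true  | yes _ = refl
  ... | true  | no ne = ⊥-elim (ne (unique v fv))
  ... | false | _     = refl

countB≡1-elim : ∀ {n} (f : Fin n → Bool) → countB f ≡ 1 →
  Σ (Fin n) (λ w → f w ≡ true × (∀ v → f v ≡ true → v ≡ w))
countB≡1-elim f e with countB≡suc⇒witness {f = f} e
... | w , p = w , p , unique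
  where
  unique : ∀ v → f v ≡ true → v ≡ w
  unique v q with v ≟ w
  ... | yes eq = eq
  ... | no ne  = ⊥-elim (true⇒countB≢0 v (∧-intro q (≢⇒≠ ne))
                   (suc-injective (trans (sym (countB-remove f w p)) e)))

countB≡3-cases : ∀ {n} (f : Fin n → Bool) (a b c : Fin n) → countB f ≡ 3 →
  f a ≡ true → f b ≡ true → f c ≡ true → a ≢ b → a ≢ c → b ≢ c →
  ∀ v → f v ≡ true → v ≡ a ⊎ v ≡ b ⊎ v ≡ c
countB≡3-cases f a b c e fa fb fc a≢b a≢c b≢c v fv with v ≟ a | v ≟ b | v ≟ c
... | yes p | _     | _     = inj₁ p
... | no _  | yes p | _     = inj₂ (inj₁ p)
... | no _  | no _  | yes p = inj₂ (inj₂ p)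
... | no va | no vb | no vc = ⊥-elim (true⇒countB≢0 v f₃v count₃)
  where
  f₁ f₂ f₃ : _ → Bool
  f₁ v = f v ∧ (v ≠ a)
  f₂ v = f₁ v ∧ (v ≠ b)
  f₃ v = f₂ v ∧ (v ≠ c)
  count₁ : countB f₁ ≡ 2
  count₁ = suc-injective (trans (sym (countB-remove f a fa)) e)
  count₂ : countB f₂ ≡ 1
  count₂ = suc-injective (trans (sym (countB-remove f₁ b (∧-intro fb (≢⇒≠ (a≢b ∘ sym))))) count₁)
  count₃ : countB f₃ ≡ 0
  count₃ = suc-injective (trans (sym (countB-remove f₂ c
    (∧-intro (∧-intro fc (≢⇒≠ (a≢c ∘ sym))) (≢⇒≠ (b≢c ∘ sym))))) count₂)
  f₃v : f₃ v ≡ true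
  f₃v = ∧-intro (∧-intro (∧-intro fv (≢⇒≠ va)) (≢⇒≠ vb)) (≢⇒≠ vc)

countB-∘-bijection : ∀ {n} (σ ρ : Fin n → Fin n) → (∀ t → ρ (σ t) ≡ t) → (∀ s → σ (ρ s) ≡ s) →
  ∀ (f : Fin n → Bool) → countB (f ∘ σ) ≡ countB f
countB-∘-bijection {n} σ ρ ρσ σρ f = go (countB f) f refl
  where
  go : ∀ c (f : Fin n → Bool) → countB f ≡ c → countB (f ∘ σ) ≡ c
  go zero    f e = countB-none (λ t → countB≡0⇒false e (σ t))
  go (suc c) f e with countB≡suc⇒witness {f = f} e
  ... | w , p = trans (countB-remove (f ∘ σ) (ρ w) (trans (cong f (σρ w)) p))
                  (cong suc (trans (countB-cong pulled-back) (go c f′ e′)))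
    where
    f′ : Fin n → Bool
    f′ v = f v ∧ (v ≠ w)
    e′ : countB f′ ≡ c
    e′ = suc-injective (trans (sym (countB-remove f w p)) e)
    pulled-back : ∀ t → (f (σ t) ∧ (t ≠ ρ w)) ≡ f′ (σ t)
    pulled-back t = cong (λ z → f (σ t) ∧ not z)
      (⌊⌋-⇔ (t ≟ ρ w) (σ t ≟ w) (λ q → trans (cong σ q) (σρ w))
        (λ q → trans (sym (ρσ t)) (cong ρ q)))

countB-complement : ∀ {n} (f : Fin n → Bool) → countB f + countB (not ∘ f) ≡ n
countB-complement {zero}  f = refl
countB-complement {suc n} f with f zero
... | true  = cong suc (countB-complement (f ∘ suc))
... | false = trans (+-suc (countB (f ∘ suc)) _) (cong suc (countB-complement (f ∘ suc)))

countB-∨-disjoint : ∀ {n} (f g : Fin n → Bool) → (∀ i → (f i ∧ g i) ≡ false) →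
  countB (λ i → f i ∨ g i) ≡ countB f + countB g
countB-∨-disjoint {zero}  f g h = refl
countB-∨-disjoint {suc n} f g h with f zero | g zero | h zero
... | true  | true  | ()
... | true  | false | _ = cong suc (countB-∨-disjoint (f ∘ suc) (g ∘ suc) (h ∘ suc))
... | false | true  | _ =
  trans (cong suc (countB-∨-disjoint (f ∘ suc) (g ∘ suc) (h ∘ suc)))
    (sym (+-suc (countB (f ∘ suc)) _))
... | false | false | _ = countB-∨-disjoint (f ∘ suc) (g ∘ suc) (h ∘ suc)

encodeΣ : ∀ {l} (sizes : Fin l → ℕ) → Σ (Fin l) (Fin ∘ sizes) → Fin (sumN sizes)
encodeΣ {suc l} sizes (zero , a)  = a ↑ˡ sumN (sizes ∘ suc)
encodeΣ {suc l} sizes (suc i , b) = sizes zero ↑ʳ encodeΣ (sizes ∘ suc) (i , b)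

module Encoding (k : ℕ) (P : Fin k → Piece) where
  open Construction k P

  decodeΣ-encodeΣ : ∀ {l} (sizes : Fin l → ℕ) p → decodeΣ sizes (encodeΣ sizes p) ≡ p
  decodeΣ-encodeΣ {suc l} sizes (zero , a)
    rewrite splitAt-↑ˡ (sizes zero) a (sumN (sizes ∘ suc)) = refl
  decodeΣ-encodeΣ {suc l} sizes (suc i , b)
    rewrite splitAt-↑ʳ (sizes zero) (sumN (sizes ∘ suc)) (encodeΣ (sizes ∘ suc) (i , b))
          | decodeΣ-encodeΣ (sizes ∘ suc) (i , b) = refl

  encodeΣ-decodeΣ : ∀ {l} (sizes : Fin l → ℕ) j → encodeΣ sizes (decodeΣ sizes j) ≡ j
  encodeΣ-decodeΣ {suc l} sizes j with splitAt (sizes zero) j in eq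
  ... | inj₁ a = splitAt⁻¹-↑ˡ eq
  ... | inj₂ b = trans (cong (sizes zero ↑ʳ_) (encodeΣ-decodeΣ (sizes ∘ suc) b)) (splitAt⁻¹-↑ʳ eq)

  sizes : Fin k → ℕ
  sizes i = Piece.m (P i)

  encode : Vtx k P → Fin N
  encode (hv i j) = encodeΣ sizes (i , j) ↑ˡ (k + (k + (k + (k ∸ 2))))
  encode (av i)   = nH ↑ʳ (i ↑ˡ (k + (k + (k ∸ 2))))
  encode (bv i)   = nH ↑ʳ (k ↑ʳ (i ↑ˡ (k + (k ∸ 2))))
  encode (cv i)   = nH ↑ʳ (k ↑ʳ (k ↑ʳ (i ↑ˡ (k ∸ 2))))
  encode (vv j)   = nH ↑ʳ (k ↑ʳ (k ↑ʳ (k ↑ʳ j)))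

  decode-encode : ∀ u → decode (encode u) ≡ u
  decode-encode (hv i j)
    rewrite splitAt-↑ˡ nH (encodeΣ sizes (i , j)) (k + (k + (k + (k ∸ 2))))
          | decodeΣ-encodeΣ sizes (i , j) = refl
  decode-encode (av i)
    rewrite splitAt-↑ʳ nH (k + (k + (k + (k ∸ 2)))) (i ↑ˡ (k + (k + (k ∸ 2))))
          | splitAt-↑ˡ k i (k + (k + (k ∸ 2))) = refl
  decode-encode (bv i)
    rewrite splitAt-↑ʳ nH (k + (k + (k + (k ∸ 2)))) (k ↑ʳ (i ↑ˡ (k + (k ∸ 2))))
          | splitAt-↑ʳ k (k + (k + (k ∸ 2))) (i ↑ˡ (k + (k ∸ 2)))
          | splitAt-↑ˡ k i (k + (k ∸ 2)) = refl
  decode-encode (cv i)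
    rewrite splitAt-↑ʳ nH (k + (k + (k + (k ∸ 2)))) (k ↑ʳ (k ↑ʳ (i ↑ˡ (k ∸ 2))))
          | splitAt-↑ʳ k (k + (k + (k ∸ 2))) (k ↑ʳ (i ↑ˡ (k ∸ 2)))
          | splitAt-↑ʳ k (k + (k ∸ 2)) (i ↑ˡ (k ∸ 2))
          | splitAt-↑ˡ k i (k ∸ 2) = refl
  decode-encode (vv j)
    rewrite splitAt-↑ʳ nH (k + (k + (k + (k ∸ 2)))) (k ↑ʳ (k ↑ʳ (k ↑ʳ j)))
          | splitAt-↑ʳ k (k + (k + (k ∸ 2))) (k ↑ʳ (k ↑ʳ j))
          | splitAt-↑ʳ k (k + (k ∸ 2)) (k ↑ʳ j)
          | splitAt-↑ʳ k (k ∸ 2) j = refl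

  encode-decode : ∀ u → encode (decode u) ≡ u
  encode-decode u with splitAt nH u in e₀
  ... | inj₁ h = trans (cong (_↑ˡ (k + (k + (k + (k ∸ 2))))) (encodeΣ-decodeΣ sizes h))
    (splitAt⁻¹-↑ˡ e₀)
  ... | inj₂ r with splitAt k r in e₁
  ...   | inj₁ i = trans (cong (nH ↑ʳ_) (splitAt⁻¹-↑ˡ e₁)) (splitAt⁻¹-↑ʳ e₀)
  ...   | inj₂ r₁ with splitAt k r₁ in e₂
  ...     | inj₁ i = trans
    (cong (nH ↑ʳ_) (trans (cong (k ↑ʳ_) (splitAt⁻¹-↑ˡ e₂)) (splitAt⁻¹-↑ʳ e₁)))
                       (splitAt⁻¹-↑ʳ e₀)
  ...     | inj₂ r₂ with splitAt k r₂ in e₃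
  ...       | inj₁ i = trans
    (cong (nH ↑ʳ_) (trans (cong (k ↑ʳ_) (trans (cong (k ↑ʳ_) (splitAt⁻¹-↑ˡ e₃))
                         (splitAt⁻¹-↑ʳ e₂))) (splitAt⁻¹-↑ʳ e₁))) (splitAt⁻¹-↑ʳ e₀)
  ...       | inj₂ j = trans
    (cong (nH ↑ʳ_) (trans (cong (k ↑ʳ_) (trans (cong (k ↑ʳ_) (splitAt⁻¹-↑ʳ e₃))
                         (splitAt⁻¹-↑ʳ e₂))) (splitAt⁻¹-↑ʳ e₁))) (splitAt⁻¹-↑ʳ e₀)

_==ᵛ_ : ∀ {k P} → Vtx k P → Vtx k P → Bool
hv i j ==ᵛ hv i′ j′ with i ≟ i′
... | yes refl = j ==F j′
... | no _     = false
av i ==ᵛ av i′ = i ==F i′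
bv i ==ᵛ bv i′ = i ==F i′
cv i ==ᵛ cv i′ = i ==F i′
vv i ==ᵛ vv i′ = i ==F i′
_    ==ᵛ _     = false

==ᵛ-refl : ∀ {k P} (u : Vtx k P) → (u ==ᵛ u) ≡ true
==ᵛ-refl (hv i j) with i ≟ i
... | yes refl = ==F-refl j
... | no ne    = ⊥-elim (ne refl)
==ᵛ-refl (av i) = ==F-refl i
==ᵛ-refl (bv i) = ==F-refl i
==ᵛ-refl (cv i) = ==F-refl i
==ᵛ-refl (vv i) = ==F-refl i

==ᵛ-sound : ∀ {k P} (u v : Vtx k P) → (u ==ᵛ v) ≡ true → u ≡ v
==ᵛ-sound (hv i j) (hv i′ j′) e with i ≟ i′
... | yes refl = cong (hv i) (==F-sound j j′ e)
==ᵛ-sound (av i) (av i′) e = cong av (==F-sound i i′ e)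
==ᵛ-sound (bv i) (bv i′) e = cong bv (==F-sound i i′ e)
==ᵛ-sound (cv i) (cv i′) e = cong cv (==F-sound i i′ e)
==ᵛ-sound (vv i) (vv i′) e = cong vv (==F-sound i i′ e)

==ᵛ-false : ∀ {k P} (u v : Vtx k P) → u ≢ v → (u ==ᵛ v) ≡ false
==ᵛ-false u v ne with u ==ᵛ v in e
... | true  = ⊥-elim (ne (==ᵛ-sound u v e))
... | false = refl

==ᵛ-hv : ∀ {k P} (i : Fin k) j j′ → (hv {k} {P} i j ==ᵛ hv i j′) ≡ (j ==F j′)
==ᵛ-hv i j j′ with i ≟ i
... | yes refl = refl
... | no ne    = ⊥-elim (ne refl)

involution-==ᵛ-sym : ∀ {k P} (p : Vtx k P → Vtx k P) → (∀ u → p (p u) ≡ u) →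
  ∀ u v → (p u ==ᵛ v) ≡ (p v ==ᵛ u)
involution-==ᵛ-sym p involutive u v = Bool-⇔⇒≡ (swap u v) (swap v u)
  where
  swap : ∀ u v → (p u ==ᵛ v) ≡ true → (p v ==ᵛ u) ≡ true
  swap u v e = trans (cong (_==ᵛ u) (trans (cong p (sym (==ᵛ-sound (p u) v e))) (involutive u)))
    (==ᵛ-refl u)

hv-injectiveˡ : ∀ {k P} {i i′ : Fin k} {j j′} → hv {k} {P} i j ≡ hv i′ j′ → i ≡ i′
hv-injectiveˡ refl = refl

punchIn-dropAt : ∀ {m} (x y : Fin (2 + m)) → x ≢ y → punchIn x (dropAt x y) ≡ y
punchIn-dropAt zero    zero    ne = ⊥-elim (ne refl)
punchIn-dropAt zero    (suc y) ne = refl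
punchIn-dropAt (suc x) zero    ne = refl
punchIn-dropAt {zero}  (suc zero) (suc zero) ne = ⊥-elim (ne refl)
punchIn-dropAt {suc m} (suc x) (suc y) ne = cong suc (punchIn-dropAt x y (ne ∘ cong suc))

module Deletion {m} (x y : Fin (2 + m)) (x≢y : x ≢ y) where
  emb : Fin m → Fin (2 + m)
  emb = embH x y

  emb≢x : ∀ j → emb j ≢ x
  emb≢x j = punchInᵢ≢i x (punchIn (dropAt x y) j)

  emb≢y : ∀ j → emb j ≢ y
  emb≢y j e = punchInᵢ≢i (dropAt x y) j
    (punchIn-injective x (punchIn (dropAt x y) j) (dropAt x y)
      (trans e (sym (punchIn-dropAt x y x≢y))))

  emb-injective : ∀ j j′ → emb j ≡ emb j′ → j ≡ j′
  emb-injective j j′ e = punchIn-injective (dropAt x y) j j′ (punchIn-injective x _ _ e)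

  emb-onto : ∀ w → w ≢ x → w ≢ y → Σ (Fin m) (λ j → emb j ≡ w)
  emb-onto w w≢x w≢y =
    punchOut w′≢d , trans (cong (punchIn x) (punchIn-punchOut w′≢d)) (punchIn-punchOut x≢w)
    where
    x≢w : x ≢ w
    x≢w = w≢x ∘ sym
    w′≢d : dropAt x y ≢ punchOut x≢w
    w′≢d e = w≢y (trans (sym (punchIn-punchOut x≢w))
                   (trans (cong (punchIn x) (sym e)) (punchIn-dropAt x y x≢y)))

  emb⁻¹ : ∀ w → w ≢ x → w ≢ y → Fin m
  emb⁻¹ w w≢x w≢y = proj₁ (emb-onto w w≢x w≢y)

  emb-emb⁻¹ : ∀ w w≢x w≢y → emb (emb⁻¹ w w≢x w≢y) ≡ w
  emb-emb⁻¹ w w≢x w≢y = proj₂ (emb-onto w w≢x w≢y)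

  data View (w : Fin (2 + m)) : Set where
    isX : w ≡ x → View w
    isY : w ≡ y → View w
    isH : (j : Fin m) → emb j ≡ w → View w

  view : ∀ w → View w
  view w with w ≟ x | w ≟ y
  ... | yes p   | _     = isX p
  ... | no _    | yes p = isY p
  ... | no w≢x  | no w≢y = isH (emb⁻¹ w w≢x w≢y) (emb-emb⁻¹ w w≢x w≢y)

allFin : ∀ {n} → (Fin n → Bool) → Bool
allFin {zero}  p = true
allFin {suc n} p = p zero ∧ allFin (p ∘ suc)

allFin-sound : ∀ {n} (p : Fin n → Bool) → allFin p ≡ true → ∀ i → p i ≡ true
allFin-sound {suc n} p e zero    = ∧-conicalˡ (p zero) _ e
allFin-sound {suc n} p e (suc i) = allFin-sound (p ∘ suc) (∧-conicalʳ (p zero) _ e) i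

-- How a perfect matching of G meets the edge xy: it contains xy, or it avoids xy and
-- uses x x¹ (α) or x x⁰ (not α) at x, and y y¹ (β) or y y⁰ (not β) at y.
data EdgeState : Set where
  onEdge  : EdgeState
  offEdge : (α β : Bool) → EdgeState

atXY atX¹ atX⁰ atY¹ atY⁰ : EdgeState → Bool
atXY onEdge        = true
atXY (offEdge _ _) = false
atX¹ onEdge        = false
atX¹ (offEdge α _) = α
atX⁰ onEdge        = false
atX⁰ (offEdge α _) = not α
atY¹ onEdge        = false
atY¹ (offEdge _ β) = β
atY⁰ onEdge        = false
atY⁰ (offEdge _ β) = not β

_==ᵇ_ : Bool → Bool → Bool
true  ==ᵇ b = b
false ==ᵇ b = not b

==ᵇ-sound : ∀ a b → (a ==ᵇ b) ≡ true → a ≡ b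
==ᵇ-sound true  true  _ = refl
==ᵇ-sound false false _ = refl

_==ˢ_ : EdgeState → EdgeState → Bool
onEdge      ==ˢ onEdge        = true
offEdge α β ==ˢ offEdge α′ β′ = (α ==ᵇ α′) ∧ (β ==ᵇ β′)
_           ==ˢ _             = false

==ˢ-sound : ∀ s s′ → (s ==ˢ s′) ≡ true → s ≡ s′
==ˢ-sound onEdge        onEdge          _ = refl
==ˢ-sound (offEdge α β) (offEdge α′ β′) e =
  cong₂ offEdge (==ᵇ-sound α α′ (∧-conicalˡ (α ==ᵇ α′) _ e))
    (==ᵇ-sound β β′ (∧-conicalʳ (α ==ᵇ α′) _ e))

flipState : EdgeState → EdgeState
flipState onEdge        = onEdge
flipState (offEdge α β) = offEdge (not α) (not β)

-- The normal form of a Fulkerson cover at xy: two matchings through xy and two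
-- complementary pairs avoiding it.
canonical : (α₁ β₁ α₂ β₂ : Bool) → Fin 6 → EdgeState
canonical α₁ β₁ α₂ β₂ zero                                = onEdge
canonical α₁ β₁ α₂ β₂ (suc zero)                          = onEdge
canonical α₁ β₁ α₂ β₂ (suc (suc zero))                    = offEdge α₁ β₁
canonical α₁ β₁ α₂ β₂ (suc (suc (suc zero)))              = offEdge (not α₁) (not β₁)
canonical α₁ β₁ α₂ β₂ (suc (suc (suc (suc zero))))        = offEdge α₂ β₂
canonical α₁ β₁ α₂ β₂ (suc (suc (suc (suc (suc zero))))) = offEdge (not α₂) (not β₂)

Balanced : (Fin 6 → EdgeState) → Set
Balanced τ = countB (atXY ∘ τ) ≡ 2 × countB (atX¹ ∘ τ) ≡ 2 × countB (atX⁰ ∘ τ) ≡ 2 ×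
             countB (atY¹ ∘ τ) ≡ 2 × countB (atY⁰ ∘ τ) ≡ 2

balanced : (Fin 6 → EdgeState) → Bool
balanced τ = (countB (atXY ∘ τ) ≡ᵇ 2) ∧ ((countB (atX¹ ∘ τ) ≡ᵇ 2) ∧ ((countB (atX⁰ ∘ τ) ≡ᵇ 2) ∧
             ((countB (atY¹ ∘ τ) ≡ᵇ 2) ∧ (countB (atY⁰ ∘ τ) ≡ᵇ 2))))

record Sorted (τ : Fin 6 → EdgeState) : Set where
  field
    order order⁻¹ : Fin 6 → Fin 6
    order-order⁻¹ : ∀ s → order (order⁻¹ s) ≡ s
    order⁻¹-order : ∀ t → order⁻¹ (order t) ≡ t
    α₁ β₁ α₂ β₂   : Bool
    sorted        : ∀ s → τ (order s) ≡ canonical α₁ β₁ α₂ β₂ s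

nth : List (Fin 6) → ℕ → Fin 6
nth []       _       = zero
nth (s ∷ _)  zero    = s
nth (_ ∷ ss) (suc n) = nth ss n

module Sorting (τ : Fin 6 → EdgeState) where
  slots onSlots offSlots : List (Fin 6)
  slots    = # 0 ∷ # 1 ∷ # 2 ∷ # 3 ∷ # 4 ∷ # 5 ∷ []
  onSlots  = filter (λ s → T? (atXY (τ s))) slots
  offSlots = filter (λ s → T? (not (atXY (τ s)))) slots

  first partner : Fin 6
  first   = nth offSlots 0
  partner = nth (filter (λ s → T? (τ s ==ˢ flipState (τ first))) offSlots) 0

  others : List (Fin 6)
  others = filter (λ s → T? (not (s ==F first) ∧ not (s ==F partner))) offSlots

  order : Fin 6 → Fin 6
  order zero                                = nth onSlots 0
  order (suc zero)                          = nth onSlots 1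
  order (suc (suc zero))                    = first
  order (suc (suc (suc zero)))              = partner
  order (suc (suc (suc (suc zero))))        = nth others 0
  order (suc (suc (suc (suc (suc zero))))) = nth others 1

  order⁻¹ : Fin 6 → Fin 6
  order⁻¹ s = if order (# 0) ==F s then # 0 else if order (# 1) ==F s then # 1 else
              if order (# 2) ==F s then # 2 else if order (# 3) ==F s then # 3 else
              if order (# 4) ==F s then # 4 else # 5

  α₁ β₁ α₂ β₂ : Bool
  α₁ = atX¹ (τ first)
  β₁ = atY¹ (τ first)
  α₂ = atX¹ (τ (nth others 0))
  β₂ = atY¹ (τ (nth others 0))

  right-inverse left-inverse normal : Fin 6 → Bool
  right-inverse s = order (order⁻¹ s) ==F s
  left-inverse  t = order⁻¹ (order t) ==F t
  normal        s = τ (order s) ==ˢ canonical α₁ β₁ α₂ β₂ s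

  succeeds : Bool
  succeeds = allFin right-inverse ∧ (allFin left-inverse ∧ allFin normal)

  sorting : succeeds ≡ true → Sorted τ
  sorting e = record
    { order = order ; order⁻¹ = order⁻¹
    ; order-order⁻¹ = λ s → ==F-sound _ _ (allFin-sound right-inverse (∧-conicalˡ _ _ e) s)
    ; order⁻¹-order = λ t → ==F-sound _ _ (allFin-sound left-inverse (∧-conicalˡ _ _ e′) t)
    ; α₁ = α₁ ; β₁ = β₁ ; α₂ = α₂ ; β₂ = β₂
    ; sorted = λ s → ==ˢ-sound _ _ (allFin-sound normal (∧-conicalʳ (allFin left-inverse) _ e′) s)
    }
    where
    e′ = ∧-conicalʳ (allFin right-inverse) _ e

states : Fin 5 → EdgeState
states = onEdge Table.∷ offEdge false false Table.∷ offEdge false true Table.∷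
         offEdge true false Table.∷ offEdge true true Table.∷ Table.[]

allStates : (EdgeState → Bool) → Bool
allStates p = allFin (p ∘ states)

allStates-sound : ∀ p → allStates p ≡ true → ∀ s → p s ≡ true
allStates-sound p e onEdge                = allFin-sound (p ∘ states) e (# 0)
allStates-sound p e (offEdge false false) = allFin-sound (p ∘ states) e (# 1)
allStates-sound p e (offEdge false true)  = allFin-sound (p ∘ states) e (# 2)
allStates-sound p e (offEdge true false)  = allFin-sound (p ∘ states) e (# 3)
allStates-sound p e (offEdge true true)   = allFin-sound (p ∘ states) e (# 4)

emptyTable : Fin 0 → EdgeState
emptyTable ()

allTables : ∀ n → ((Fin n → EdgeState) → Bool) → Bool
allTables zero    p = p emptyTable
allTables (suc n) p = allStates (λ s → allTables n (λ τ → p (s Table.∷ τ)))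

rebuild : ∀ {n} → (Fin n → EdgeState) → Fin n → EdgeState
rebuild {zero}  τ = emptyTable
rebuild {suc n} τ = τ zero Table.∷ rebuild (τ ∘ suc)

rebuild-≗ : ∀ {n} (τ : Fin n → EdgeState) i → rebuild τ i ≡ τ i
rebuild-≗ τ zero    = refl
rebuild-≗ τ (suc i) = rebuild-≗ (τ ∘ suc) i

allTables-sound : ∀ n p → allTables n p ≡ true → ∀ τ → p (rebuild τ) ≡ true
allTables-sound zero    p e τ = e
allTables-sound (suc n) p e τ =
  allTables-sound n (λ τ′ → p (τ zero Table.∷ τ′))
    (allStates-sound (λ s → allTables n (λ τ′ → p (s Table.∷ τ′))) e (τ zero)) (τ ∘ suc)

sortable : (Fin 6 → EdgeState) → Bool
sortable τ = not (balanced τ) ∨ Sorting.succeeds τ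

sorting-exhaustive : allTables 6 sortable ≡ true
sorting-exhaustive = refl

resolve : ∀ {a b} → (not a ∨ b) ≡ true → a ≡ true → b ≡ true
resolve e refl = e

≡2⇒≡ᵇ2 : ∀ {a} → a ≡ 2 → (a ≡ᵇ 2) ≡ true
≡2⇒≡ᵇ2 refl = refl

opaque
  sort : ∀ τ → Balanced τ → Sorted τ
  sort τ (c₁ , c₂ , c₃ , c₄ , c₅) = transport (Sorting.sorting τ′ succeeds)
    where
    τ′ : Fin 6 → EdgeState
    τ′ = rebuild τ
    count : ∀ (g : EdgeState → Bool) → countB (g ∘ τ) ≡ 2 → (countB (g ∘ τ′) ≡ᵇ 2) ≡ true
    count g e = ≡2⇒≡ᵇ2 (trans (countB-cong (λ s → cong g (rebuild-≗ τ s))) e)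
    balanced′ : balanced τ′ ≡ true
    balanced′ = ∧-intro (count atXY c₁) (∧-intro (count atX¹ c₂)
                  (∧-intro (count atX⁰ c₃) (∧-intro (count atY¹ c₄) (count atY⁰ c₅))))
    succeeds : Sorting.succeeds τ′ ≡ true
    succeeds = resolve (allTables-sound 6 sortable sorting-exhaustive τ) balanced′
    transport : Sorted τ′ → Sorted τ
    transport S = record
      { Sorted S
      ; sorted = λ s → trans (sym (rebuild-≗ τ (Sorted.order S s))) (Sorted.sorted S s) }

module CoverAtEdge (P : Piece) (VP : ValidPiece P) where
  open Piece P public
  open ValidPiece VP public

  matching : Fin 6 → PerfectMatching G
  matching = proj₁ fulkerson

  M : Fin 6 → Fin (2 + m) → Fin (2 + m) → Bool
  M s = PerfectMatching.M (matching s)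

  covers-twice : ∀ u v → G u v ≡ true → countB (λ s → M s u v) ≡ 2
  covers-twice = proj₂ fulkerson

  M-sym : ∀ s u v → M s u v ≡ M s v u
  M-sym s = PerfectMatching.sym (matching s)

  M⊆G : ∀ s u v → M s u v ≡ true → G u v ≡ true
  M⊆G s = PerfectMatching.sub (matching s)

  private
    unique-mate : ∀ s u → Σ _ (λ w → M s u w ≡ true × (∀ v → M s u v ≡ true → v ≡ w))
    unique-mate s u = countB≡1-elim (M s u) (PerfectMatching.perfect (matching s) u)

  mate : Fin 6 → Fin (2 + m) → Fin (2 + m)
  mate s u = proj₁ (unique-mate s u)

  M-mate : ∀ s u → M s u (mate s u) ≡ true
  M-mate s u = proj₁ (proj₂ (unique-mate s u))

  mate-unique : ∀ s u v → M s u v ≡ true → v ≡ mate s u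
  mate-unique s u = proj₂ (proj₂ (unique-mate s u))

  M-at-mate : ∀ s u {v} → v ≡ mate s u → M s u v ≡ true
  M-at-mate s u refl = M-mate s u

  M≡mate : ∀ s u v → M s u v ≡ (v ==F mate s u)
  M≡mate s u v with v ≟ mate s u
  ... | yes refl = M-mate s u
  ... | no v≢mate with M s u v in e
  ...   | true  = ⊥-elim (v≢mate (mate-unique s u v e))
  ...   | false = refl

  M-away-from-mate : ∀ s u v → v ≢ mate s u → M s u v ≡ false
  M-away-from-mate s u v ne = trans (M≡mate s u v) (==F-false v (mate s u) ne)

  mate-of-mate : ∀ s u v → M s u v ≡ true → mate s v ≡ u
  mate-of-mate s u v e = sym (mate-unique s v u (trans (M-sym s v u) e))

  G-sym : ∀ u v → G u v ≡ G v u
  G-sym = proj₁ simple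

  adjacent⇒≢ : ∀ {u v} → G u v ≡ true → u ≢ v
  adjacent⇒≢ {u} e refl = true≢false (trans (sym e) (proj₂ simple u))

  x≢y : x ≢ y
  x≢y = adjacent⇒≢ xy
  x0≢x : x0 ≢ x
  x0≢x = adjacent⇒≢ xx0 ∘ sym
  x1≢x : x1 ≢ x
  x1≢x = adjacent⇒≢ xx1 ∘ sym
  y0≢y : y0 ≢ y
  y0≢y = adjacent⇒≢ yy0 ∘ sym
  y1≢y : y1 ≢ y
  y1≢y = adjacent⇒≢ yy1 ∘ sym

  neighbours-x : ∀ v → G x v ≡ true → v ≡ y ⊎ v ≡ x0 ⊎ v ≡ x1
  neighbours-x = countB≡3-cases (G x) y x0 x1 (cubic x) xy xx0 xx1 (x0≢y ∘ sym) (x1≢y ∘ sym) x0≢x1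

  neighbours-y : ∀ v → G y v ≡ true → v ≡ x ⊎ v ≡ y0 ⊎ v ≡ y1
  neighbours-y = countB≡3-cases (G y) x y0 y1 (cubic y) (trans (G-sym y x) xy) yy0 yy1
                   (y0≢x ∘ sym) (y1≢x ∘ sym) y0≢y1

  one-of-two : ∀ s u a b c → (∀ v → G u v ≡ true → v ≡ a ⊎ v ≡ b ⊎ v ≡ c) → b ≢ c →
    M s u a ≡ false → not (M s u c) ≡ M s u b
  one-of-two s u a b c neighbours b≢c ua with neighbours (mate s u) (M⊆G s u _ (M-mate s u))
  ... | inj₁ refl = ⊥-elim (true≢false (trans (sym (M-mate s u)) ua))
  ... | inj₂ (inj₁ refl) rewrite M-mate s u = cong not (M-away-from-mate s u c (b≢c ∘ sym))
  ... | inj₂ (inj₂ refl) rewrite M-mate s u = sym (M-away-from-mate s u b b≢c)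

  state : Fin 6 → EdgeState
  state s = if M s x y then onEdge else offEdge (M s x x1) (M s y y1)

  record Reading (s : Fin 6) : Set where
    field
      reads-xy : atXY (state s) ≡ M s x y
      reads-x¹ : atX¹ (state s) ≡ M s x x1
      reads-x⁰ : atX⁰ (state s) ≡ M s x x0
      reads-y¹ : atY¹ (state s) ≡ M s y y1
      reads-y⁰ : atY⁰ (state s) ≡ M s y y0

  state-on : ∀ s → M s x y ≡ true → state s ≡ onEdge
  state-on s e rewrite e = refl

  state-off : ∀ s → M s x y ≡ false → state s ≡ offEdge (M s x x1) (M s y y1)
  state-off s e rewrite e = refl

  reading : ∀ s → Reading s
  reading s = by-cases (M s x y) refl
    where
    by-cases : ∀ b → M s x y ≡ b → Reading s
    by-cases true sxy = record
      { reads-xy = trans (cong atXY on) (sym sxy)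
      ; reads-x¹ = trans (cong atX¹ on) (sym (away-x x1 x1≢y))
      ; reads-x⁰ = trans (cong atX⁰ on) (sym (away-x x0 x0≢y))
      ; reads-y¹ = trans (cong atY¹ on) (sym (away-y y1 y1≢x))
      ; reads-y⁰ = trans (cong atY⁰ on) (sym (away-y y0 y0≢x))
      }
      where
      on : state s ≡ onEdge
      on = state-on s sxy
      away-x : ∀ v → v ≢ y → M s x v ≡ false
      away-x v v≢y = M-away-from-mate s x v (λ e → v≢y (trans e (sym (mate-unique s x y sxy))))
      away-y : ∀ v → v ≢ x → M s y v ≡ false
      away-y v v≢x = M-away-from-mate s y v (λ e → v≢x (trans e (mate-of-mate s x y sxy)))
    by-cases false sxy = record
      { reads-xy = trans (cong atXY off) (sym sxy)
      ; reads-x¹ = cong atX¹ off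
      ; reads-x⁰ = trans (cong atX⁰ off) (one-of-two s x y x0 x1 neighbours-x x0≢x1 sxy)
      ; reads-y¹ = cong atY¹ off
      ; reads-y⁰ = trans (cong atY⁰ off)
                     (one-of-two s y x y0 y1 neighbours-y y0≢y1 (trans (M-sym s y x) sxy))
      }
      where
      off : state s ≡ offEdge (M s x x1) (M s y y1)
      off = state-off s sxy

  balanced-states : Balanced state
  balanced-states =
      trans (countB-cong (Reading.reads-xy ∘ reading)) (covers-twice x y xy)
    , trans (countB-cong (Reading.reads-x¹ ∘ reading)) (covers-twice x x1 xx1)
    , trans (countB-cong (Reading.reads-x⁰ ∘ reading)) (covers-twice x x0 xx0)
    , trans (countB-cong (Reading.reads-y¹ ∘ reading)) (covers-twice y y1 yy1)
    , trans (countB-cong (Reading.reads-y⁰ ∘ reading)) (covers-twice y y0 yy0)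

  sorted-states : Sorted state
  sorted-states = sort state balanced-states

  open Deletion x y x≢y public

  hx0 hx1 hy0 hy1 : Fin m
  hx0 = emb⁻¹ x0 x0≢x x0≢y
  hx1 = emb⁻¹ x1 x1≢x x1≢y
  hy0 = emb⁻¹ y0 y0≢x y0≢y
  hy1 = emb⁻¹ y1 y1≢x y1≢y

fromℕ≤ : ∀ m → ℕ → Fin (suc m)
fromℕ≤ m zero = zero
fromℕ≤ zero (suc q) = zero
fromℕ≤ (suc m) (suc q) = suc (fromℕ≤ m q)

fromℕ≤-toℕ : ∀ m (j : Fin (suc m)) → fromℕ≤ m (toℕ j) ≡ j
fromℕ≤-toℕ m zero = refl
fromℕ≤-toℕ (suc m) (suc j) = cong suc (fromℕ≤-toℕ m j)

toℕ-fromℕ≤ : ∀ m q → q ≤ m → toℕ (fromℕ≤ m q) ≡ q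
toℕ-fromℕ≤ m zero _ = refl
toℕ-fromℕ≤ (suc m) (suc q) (s≤s le) = cong suc (toℕ-fromℕ≤ m q le)

module Cyclic (n : ℕ) where
  K : ℕ
  K = 3 + n

  next prevN : ℕ → ℕ
  next q = if q ≡ᵇ 2 + n then 0 else suc q
  prevN zero    = 2 + n
  prevN (suc q) = q

  toPiece : ℕ → Fin K
  toPiece = fromℕ≤ (2 + n)

  nextPiece prevPiece : Fin K → Fin K
  nextPiece i = toPiece (next (toℕ i))
  prevPiece i = toPiece (prevN (toℕ i))

  toℕ≤2+n : ∀ (i : Fin K) → toℕ i ≤ suc (suc n)
  toℕ≤2+n i = ≤-pred (toℕ<n i)

  next-spec : ∀ q b → (q ≡ᵇ suc (suc n)) ≡ b → next q ≡ (if b then 0 else suc q)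
  next-spec q b refl = refl

  next≤ : ∀ q → q ≤ suc (suc n) → next q ≤ suc (suc n)
  next≤ q le with q ≡ᵇ suc (suc n) in e
  ... | true = z≤n
  ... | false = ≤∧≢⇒< le (λ x → true≢false (trans (sym (≡ᵇ-complete x)) e))

  toℕ-nextPiece : ∀ i → toℕ (nextPiece i) ≡ next (toℕ i)
  toℕ-nextPiece i = toℕ-fromℕ≤ (suc (suc n)) (next (toℕ i)) (next≤ (toℕ i) (toℕ≤2+n i))

  prevN≤ : ∀ q → q ≤ suc (suc n) → prevN q ≤ suc (suc n)
  prevN≤ zero _ = ≤-refl
  prevN≤ (suc q) le = ≤-trans (n≤1+n q) le

  toℕ-prevPiece : ∀ i → toℕ (prevPiece i) ≡ prevN (toℕ i)
  toℕ-prevPiece i = toℕ-fromℕ≤ (suc (suc n)) (prevN (toℕ i)) (prevN≤ (toℕ i) (toℕ≤2+n i))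

  next-prevN : ∀ q → q ≤ suc (suc n) → next (prevN q) ≡ q
  next-prevN zero _ = next-spec (suc (suc n)) true (≡ᵇ-refl (suc (suc n)))
  next-prevN (suc q) le = next-spec q false
    (≡ᵇ-false (λ x → 1+n≰n (subst (λ z → suc z ≤ suc (suc n)) x le)))

  prevN-next : ∀ q → q ≤ suc (suc n) → prevN (next q) ≡ q
  prevN-next q le with q ≡ᵇ suc (suc n) in e
  ... | true = sym (≡ᵇ-sound _ _ e)
  ... | false = refl

  nextPiece-prevPiece : ∀ i → nextPiece (prevPiece i) ≡ i
  nextPiece-prevPiece i = toℕ-injective
    (trans (toℕ-nextPiece (prevPiece i))
    (trans (cong next (toℕ-prevPiece i)) (next-prevN (toℕ i) (toℕ≤2+n i))))

  prevPiece-nextPiece : ∀ i → prevPiece (nextPiece i) ≡ i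
  prevPiece-nextPiece i = toℕ-injective
    (trans (toℕ-prevPiece (nextPiece i))
    (trans (cong prevN (toℕ-nextPiece i)) (prevN-next (toℕ i) (toℕ≤2+n i))))

  next⇒isNextℕ : ∀ q r → r ≡ next q → ((r ≡ᵇ suc q) ∨ ((r ≡ᵇ 0) ∧ (suc q ≡ᵇ K))) ≡ true
  next⇒isNextℕ q r er = go (q ≡ᵇ suc (suc n)) refl
    where
    M : ℕ → Set
    M z = ((z ≡ᵇ suc q) ∨ ((z ≡ᵇ 0) ∧ (suc q ≡ᵇ K))) ≡ true
    go : ∀ b → (q ≡ᵇ suc (suc n)) ≡ b → M r
    go true eb = subst M (sym (trans er (next-spec q true eb))) eb
    go false eb = subst M (sym (trans er (next-spec q false eb))) (∨-introˡ (≡ᵇ-refl q))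

  isNext-nextPiece : ∀ i → isNext i (nextPiece i) ≡ true
  isNext-nextPiece i = next⇒isNextℕ (toℕ i) (toℕ (nextPiece i)) (toℕ-nextPiece i)

  isNext⇒nextPiece : ∀ (i j : Fin K) → isNext {K} i j ≡ true → j ≡ nextPiece i
  isNext⇒nextPiece i j e = toℕ-injective
    (trans (go (toℕ j ≡ᵇ suc (toℕ i)) refl e) (sym (toℕ-nextPiece i)))
    where
    go : ∀ b → (toℕ j ≡ᵇ suc (toℕ i)) ≡ b → (b ∨ ((toℕ j ≡ᵇ 0) ∧ (suc (toℕ i) ≡ᵇ K))) ≡ true →
      toℕ j ≡ next (toℕ i)
    go true e1 _ = trans jq (sym (next-spec (toℕ i) false (≡ᵇ-false ne)))
      where
      jq : toℕ j ≡ suc (toℕ i)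
      jq = ≡ᵇ-sound (toℕ j) (suc (toℕ i)) e1
      ne : ¬ toℕ i ≡ suc (suc n)
      ne x = 1+n≰n (subst (λ z → z ≤ suc (suc n)) (trans jq (cong suc x)) (toℕ≤2+n j))
    go false e1 e2 = trans z (sym (next-spec (toℕ i) true (≡ᵇ-complete (suc-injective kq))))
      where
      z : toℕ j ≡ 0
      z = ≡ᵇ-sound (toℕ j) 0 (∧-conicalˡ _ _ e2)
      kq : suc (toℕ i) ≡ K
      kq = ≡ᵇ-sound (suc (toℕ i)) K (∧-conicalʳ (toℕ j ≡ᵇ 0) _ e2)

  q≢ᵇ1+q : ∀ (q : ℕ) → (q ≡ᵇ suc q) ≡ false
  q≢ᵇ1+q zero = refl
  q≢ᵇ1+q (suc q) = q≢ᵇ1+q q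

  isNextℕ-irrefl : ∀ (q : ℕ) → ((q ≡ᵇ suc q) ∨ ((q ≡ᵇ 0) ∧ (suc q ≡ᵇ K))) ≡ false
  isNextℕ-irrefl zero = refl
  isNextℕ-irrefl (suc q) rewrite q≢ᵇ1+q q = refl

  isNext-irrefl : ∀ (i : Fin K) → isNext {K} i i ≡ false
  isNext-irrefl i = isNextℕ-irrefl (toℕ i)

  nextPiece≢ : ∀ i → ¬ nextPiece i ≡ i
  nextPiece≢ i e = true≢false
    (trans (sym (isNext-nextPiece i)) (trans (cong (isNext i) e) (isNext-irrefl i)))


-- A piece in role onAt01 (onAt23, onAt45) uses its two matchings through x y in rounds
-- 0, 1 (2, 3; 4, 5); roleOrder r t is the canonical slot it uses in round t.
data Role : Set where
  onAt01 onAt23 onAt45 : Role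

roleOrder : Role → Fin 6 → Fin 6
roleOrder onAt01 t                                      = t
roleOrder onAt23 zero                                   = # 2
roleOrder onAt23 (suc zero)                             = # 3
roleOrder onAt23 (suc (suc zero))                       = # 0
roleOrder onAt23 (suc (suc (suc zero)))                 = # 1
roleOrder onAt23 (suc (suc (suc (suc zero))))           = # 4
roleOrder onAt23 (suc (suc (suc (suc (suc zero)))))    = # 5
roleOrder onAt45 zero                                   = # 2
roleOrder onAt45 (suc zero)                             = # 3
roleOrder onAt45 (suc (suc zero))                       = # 4
roleOrder onAt45 (suc (suc (suc zero)))                 = # 5
roleOrder onAt45 (suc (suc (suc (suc zero))))           = # 0
roleOrder onAt45 (suc (suc (suc (suc (suc zero)))))    = # 1

roleOrder⁻¹ : Role → Fin 6 → Fin 6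
roleOrder⁻¹ onAt01 s                                    = s
roleOrder⁻¹ onAt23 s                                    = roleOrder onAt23 s
roleOrder⁻¹ onAt45 zero                                 = # 4
roleOrder⁻¹ onAt45 (suc zero)                           = # 5
roleOrder⁻¹ onAt45 (suc (suc zero))                     = # 0
roleOrder⁻¹ onAt45 (suc (suc (suc zero)))               = # 1
roleOrder⁻¹ onAt45 (suc (suc (suc (suc zero))))         = # 2
roleOrder⁻¹ onAt45 (suc (suc (suc (suc (suc zero))))) = # 3

roleOrder⁻¹-roleOrder : ∀ r t → roleOrder⁻¹ r (roleOrder r t) ≡ t
roleOrder⁻¹-roleOrder onAt01 t = refl
roleOrder⁻¹-roleOrder onAt23 zero = refl
roleOrder⁻¹-roleOrder onAt23 (suc zero) = refl
roleOrder⁻¹-roleOrder onAt23 (suc (suc zero)) = refl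
roleOrder⁻¹-roleOrder onAt23 (suc (suc (suc zero))) = refl
roleOrder⁻¹-roleOrder onAt23 (suc (suc (suc (suc zero)))) = refl
roleOrder⁻¹-roleOrder onAt23 (suc (suc (suc (suc (suc zero))))) = refl
roleOrder⁻¹-roleOrder onAt45 zero = refl
roleOrder⁻¹-roleOrder onAt45 (suc zero) = refl
roleOrder⁻¹-roleOrder onAt45 (suc (suc zero)) = refl
roleOrder⁻¹-roleOrder onAt45 (suc (suc (suc zero))) = refl
roleOrder⁻¹-roleOrder onAt45 (suc (suc (suc (suc zero)))) = refl
roleOrder⁻¹-roleOrder onAt45 (suc (suc (suc (suc (suc zero))))) = refl

roleOrder-roleOrder⁻¹ : ∀ r s → roleOrder r (roleOrder⁻¹ r s) ≡ s
roleOrder-roleOrder⁻¹ onAt01 s = refl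
roleOrder-roleOrder⁻¹ onAt23 s = roleOrder⁻¹-roleOrder onAt23 s
roleOrder-roleOrder⁻¹ onAt45 zero = refl
roleOrder-roleOrder⁻¹ onAt45 (suc zero) = refl
roleOrder-roleOrder⁻¹ onAt45 (suc (suc zero)) = refl
roleOrder-roleOrder⁻¹ onAt45 (suc (suc (suc zero))) = refl
roleOrder-roleOrder⁻¹ onAt45 (suc (suc (suc (suc zero)))) = refl
roleOrder-roleOrder⁻¹ onAt45 (suc (suc (suc (suc (suc zero))))) = refl

swapPairs : Bool → Bool → Fin 6 → Fin 6
swapPairs o₁ o₂ (suc (suc zero))                       = if o₁ then # 3 else # 2
swapPairs o₁ o₂ (suc (suc (suc zero)))                 = if o₁ then # 2 else # 3
swapPairs o₁ o₂ (suc (suc (suc (suc zero))))           = if o₂ then # 5 else # 4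
swapPairs o₁ o₂ (suc (suc (suc (suc (suc zero)))))    = if o₂ then # 4 else # 5
swapPairs o₁ o₂ s                                      = s

swapPairs-involutive : ∀ o₁ o₂ s → swapPairs o₁ o₂ (swapPairs o₁ o₂ s) ≡ s
swapPairs-involutive o₁     o₂     zero = refl
swapPairs-involutive o₁     o₂     (suc zero) = refl
swapPairs-involutive true   o₂     (suc (suc zero)) = refl
swapPairs-involutive false  o₂     (suc (suc zero)) = refl
swapPairs-involutive true   o₂     (suc (suc (suc zero))) = refl
swapPairs-involutive false  o₂     (suc (suc (suc zero))) = refl
swapPairs-involutive o₁     true   (suc (suc (suc (suc zero)))) = refl
swapPairs-involutive o₁     false  (suc (suc (suc (suc zero)))) = refl
swapPairs-involutive o₁     true   (suc (suc (suc (suc (suc zero))))) = refl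
swapPairs-involutive o₁     false  (suc (suc (suc (suc (suc zero))))) = refl

slotOf slotOf⁻¹ : Role → Bool → Bool → Fin 6 → Fin 6
slotOf   r o₁ o₂ t = swapPairs o₁ o₂ (roleOrder r t)
slotOf⁻¹ r o₁ o₂ s = roleOrder⁻¹ r (swapPairs o₁ o₂ s)

slotOf⁻¹-slotOf : ∀ r o₁ o₂ t → slotOf⁻¹ r o₁ o₂ (slotOf r o₁ o₂ t) ≡ t
slotOf⁻¹-slotOf r o₁ o₂ t rewrite swapPairs-involutive o₁ o₂
  (roleOrder r t) = roleOrder⁻¹-roleOrder r t

slotOf-slotOf⁻¹ : ∀ r o₁ o₂ s → slotOf r o₁ o₂ (slotOf⁻¹ r o₁ o₂ s) ≡ s
slotOf-slotOf⁻¹ r o₁ o₂ s rewrite roleOrder-roleOrder⁻¹ r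
  (swapPairs o₁ o₂ s) = swapPairs-involutive o₁ o₂ s

scheduled : Role → (o₁ o₂ α₁ β₁ α₂ β₂ : Bool) → Fin 6 → EdgeState
scheduled r o₁ o₂ α₁ β₁ α₂ β₂ t = canonical α₁ β₁ α₂ β₂ (slotOf r o₁ o₂ t)

-- Whether c_q is matched inside the spine (the tree on the c's and v's) in round t.
spineTakes : Fin 6 → ℕ → Bool
spineTakes zero                                  (suc (suc _)) = true
spineTakes (suc zero)                            (suc (suc _)) = true
spineTakes zero                                  _             = false
spineTakes (suc zero)                            _             = false
spineTakes (suc (suc zero))                      q             = q ≡ᵇ 1
spineTakes (suc (suc (suc zero)))                q             = q ≡ᵇ 1
spineTakes (suc (suc (suc (suc zero))))          q             = q ≡ᵇ 0
spineTakes (suc (suc (suc (suc (suc zero)))))   q             = q ≡ᵇ 0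

-- At the junction a_i b_i c_i, sY is the state of piece i (whose y-side is joined to a_i, b_i)
-- and sX that of piece i+1 (joined by its x-side).
aFree bFree : EdgeState → EdgeState → Bool
aFree sY sX = not (atY⁰ sY ∨ atX⁰ sX)
bFree sY sX = not (atY¹ sY ∨ atX¹ sX)

compatible : EdgeState → EdgeState → Bool → Bool
compatible sY sX d = not (atY⁰ sY ∧ atX⁰ sX) ∧ (not (atY¹ sY ∧ atX¹ sX) ∧
  (not (aFree sY sX ∧ bFree sY sX) ∧ ((not (aFree sY sX) ∧ not (bFree sY sX)) ==ᵇ d)))

compatible-off-on : ∀ α β → compatible (offEdge α β) onEdge false ≡ true
compatible-off-on α true  = refl
compatible-off-on α false = refl

compatible-on-off : ∀ α β → compatible onEdge (offEdge α β) false ≡ true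
compatible-on-off true  β = refl
compatible-on-off false β = refl

compatible-off-off : ∀ α β α′ β′ → (β ==ᵇ α′) ≡ false → compatible (offEdge α β)
  (offEdge α′ β′) true ≡ true
compatible-off-off α true  false β′ e = refl
compatible-off-off α false true  β′ e = refl

canonical-slot₂ : ∀ o o₂ α β α₂ β₂ →
  canonical α β α₂ β₂ (swapPairs o o₂ (# 2)) ≡ offEdge (o xor α) (o xor β)
canonical-slot₂ true  o₂ α β α₂ β₂ = refl
canonical-slot₂ false o₂ α β α₂ β₂ = refl

canonical-slot₃ : ∀ o o₂ α β α₂ β₂ →
  canonical α β α₂ β₂ (swapPairs o o₂ (# 3)) ≡ offEdge (not o xor α) (not o xor β)
canonical-slot₃ true  o₂ α β α₂ β₂ = refl
canonical-slot₃ false o₂ α β α₂ β₂ = refl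

canonical-slot₄ : ∀ o₁ o α β α₂ β₂ →
  canonical α β α₂ β₂ (swapPairs o₁ o (# 4)) ≡ offEdge (o xor α₂) (o xor β₂)
canonical-slot₄ o₁ true  α β α₂ β₂ = refl
canonical-slot₄ o₁ false α β α₂ β₂ = refl

canonical-slot₅ : ∀ o₁ o α β α₂ β₂ →
  canonical α β α₂ β₂ (swapPairs o₁ o (# 5)) ≡ offEdge (not o xor α₂) (not o xor β₂)
canonical-slot₅ o₁ true  α β α₂ β₂ = refl
canonical-slot₅ o₁ false α β α₂ β₂ = refl

-- The orientation o of a complementary pair turns its states into (o xor α, o xor β) and
-- (not o xor α, not o xor β); the following identities say the orientations chosen below make
-- the two claims at a junction differ.
claims-differ₁ : ∀ b a → ((((not a) xor b) xor b) ==ᵇ a) ≡ false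
claims-differ₁ true  true  = refl
claims-differ₁ true  false = refl
claims-differ₁ false true  = refl
claims-differ₁ false false = refl

claims-differ₂ : ∀ b a → (((not ((not a) xor b)) xor b) ==ᵇ not a) ≡ false
claims-differ₂ true  true  = refl
claims-differ₂ true  false = refl
claims-differ₂ false true  = refl
claims-differ₂ false false = refl

claims-differ₃ : ∀ e a′ → (e ==ᵇ ((not e xor a′) xor a′)) ≡ false
claims-differ₃ true  true  = refl
claims-differ₃ true  false = refl
claims-differ₃ false true  = refl
claims-differ₃ false false = refl

claims-differ₄ : ∀ c b a′ → ((not c xor b) ==ᵇ (not (not (c xor b) xor a′) xor a′)) ≡ false
claims-differ₄ true  true  true  = refl
claims-differ₄ true  true  false = refl
claims-differ₄ true  false true  = refl
claims-differ₄ true  false false = refl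
claims-differ₄ false true  true  = refl
claims-differ₄ false true  false = refl
claims-differ₄ false false true  = refl
claims-differ₄ false false false = refl

alternating : Bool → Role
alternating true  = onAt45
alternating false = onAt23

compatible-inner : ∀ r e o α β α₂ β₂ o₂′ α′ β′ α₂′ β₂′ t →
  compatible (scheduled (alternating e) o false α β α₂ β₂ t)
             (scheduled (alternating (not e)) (not (o xor β) xor α′) o₂′ α′ β′ α₂′ β₂′ t)
             (spineTakes t (2 + r)) ≡ true
compatible-inner r e o α β α₂ β₂ o₂′ α′ β′ α₂′ β₂′ zero = at-slot₂ e
  where
  o′ = not (o xor β) xor α′
  at-slot₂ : ∀ e → compatible (scheduled (alternating e) o false α β α₂ β₂ zero)
    (scheduled (alternating (not e)) o′ o₂′ α′ β′ α₂′ β₂′ zero) true ≡ true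
  at-slot₂ true  rewrite canonical-slot₂ o false α β α₂ β₂ | canonical-slot₂ o′ o₂′ α′ β′ α₂′ β₂′ =
    compatible-off-off (o xor α) (o xor β) (o′ xor α′) (o′ xor β′) (claims-differ₃ (o xor β) α′)
  at-slot₂ false rewrite canonical-slot₂ o false α β α₂ β₂ | canonical-slot₂ o′ o₂′ α′ β′ α₂′ β₂′ =
    compatible-off-off (o xor α) (o xor β) (o′ xor α′) (o′ xor β′) (claims-differ₃ (o xor β) α′)
compatible-inner r e o α β α₂ β₂ o₂′ α′ β′ α₂′ β₂′ (suc zero) = at-slot₃ e
  where
  o′ = not (o xor β) xor α′
  at-slot₃ : ∀ e → compatible (scheduled (alternating e) o false α β α₂ β₂ (suc zero))
    (scheduled (alternating (not e)) o′ o₂′ α′ β′ α₂′ β₂′ (suc zero)) true ≡ true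
  at-slot₃ true  rewrite canonical-slot₃ o false α β α₂ β₂ | canonical-slot₃ o′ o₂′ α′ β′ α₂′ β₂′ =
    compatible-off-off (not o xor α) (not o xor β) (not o′ xor α′) (not o′ xor β′)
      (claims-differ₄ o β α′)
  at-slot₃ false rewrite canonical-slot₃ o false α β α₂ β₂ | canonical-slot₃ o′ o₂′ α′ β′ α₂′ β₂′ =
    compatible-off-off (not o xor α) (not o xor β) (not o′ xor α′) (not o′ xor β′)
      (claims-differ₄ o β α′)
compatible-inner r true  o α β α₂ β₂ o₂′ α′ β′ α₂′ β₂′ (suc (suc zero)) =
  compatible-off-on α₂ β₂
compatible-inner r false o α β α₂ β₂ o₂′ α′ β′ α₂′ β₂′ (suc (suc zero))
  rewrite canonical-slot₄ (not (o xor β) xor α′) o₂′ α′ β′ α₂′ β₂′ =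
  compatible-on-off (o₂′ xor α₂′) (o₂′ xor β₂′)
compatible-inner r true  o α β α₂ β₂ o₂′ α′ β′ α₂′ β₂′ (suc (suc (suc zero))) =
  compatible-off-on (not α₂) (not β₂)
compatible-inner r false o α β α₂ β₂ o₂′ α′ β′ α₂′ β₂′ (suc (suc (suc zero)))
  rewrite canonical-slot₅ (not (o xor β) xor α′) o₂′ α′ β′ α₂′ β₂′ =
  compatible-on-off (not o₂′ xor α₂′) (not o₂′ xor β₂′)
compatible-inner r true  o α β α₂ β₂ o₂′ α′ β′ α₂′ β₂′ (suc (suc (suc (suc zero))))
  rewrite canonical-slot₄ (not (o xor β) xor α′) o₂′ α′ β′ α₂′ β₂′ =
  compatible-on-off (o₂′ xor α₂′) (o₂′ xor β₂′)
compatible-inner r false o α β α₂ β₂ o₂′ α′ β′ α₂′ β₂′ (suc (suc (suc (suc zero)))) =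
  compatible-off-on α₂ β₂
compatible-inner r true  o α β α₂ β₂ o₂′ α′ β′ α₂′ β₂′ (suc (suc (suc (suc (suc zero)))))
  rewrite canonical-slot₅ (not (o xor β) xor α′) o₂′ α′ β′ α₂′ β₂′ =
  compatible-on-off (not o₂′ xor α₂′) (not o₂′ xor β₂′)
compatible-inner r false o α β α₂ β₂ o₂′ α′ β′ α₂′ β₂′ (suc (suc (suc (suc (suc zero))))) =
  compatible-off-on (not α₂) (not β₂)

compatible-0 : ∀ o₁ α β α₂ β₂ o₁′ α′ β′ α₂′ β₂′ t →
  compatible (scheduled onAt23 o₁ (not α₂′ xor β₂) α β α₂ β₂ t)
             (scheduled onAt01 o₁′ false α′ β′ α₂′ β₂′ t) (spineTakes t 0) ≡ true
compatible-0 o₁ α β α₂ β₂ o₁′ α′ β′ α₂′ β₂′ zero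
  rewrite canonical-slot₂ o₁ (not α₂′ xor β₂) α β α₂ β₂ = compatible-off-on (o₁ xor α) (o₁ xor β)
compatible-0 o₁ α β α₂ β₂ o₁′ α′ β′ α₂′ β₂′ (suc zero)
  rewrite canonical-slot₃ o₁ (not α₂′ xor β₂) α β α₂ β₂ = compatible-off-on (not o₁ xor α)
    (not o₁ xor β)
compatible-0 o₁ α β α₂ β₂ o₁′ α′ β′ α₂′ β₂′ (suc (suc zero))
  rewrite canonical-slot₂ o₁′ false α′ β′ α₂′ β₂′ = compatible-on-off (o₁′ xor α′) (o₁′ xor β′)
compatible-0 o₁ α β α₂ β₂ o₁′ α′ β′ α₂′ β₂′ (suc (suc (suc zero)))
  rewrite canonical-slot₃ o₁′ false α′ β′ α₂′ β₂′ = compatible-on-off (not o₁′ xor α′)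
    (not o₁′ xor β′)
compatible-0 o₁ α β α₂ β₂ o₁′ α′ β′ α₂′ β₂′ (suc (suc (suc (suc zero))))
  rewrite canonical-slot₄ o₁ (not α₂′ xor β₂) α β α₂ β₂ =
  compatible-off-off ((not α₂′ xor β₂) xor α₂) ((not α₂′ xor β₂) xor β₂) α₂′ β₂′
    (claims-differ₁ β₂ α₂′)
compatible-0 o₁ α β α₂ β₂ o₁′ α′ β′ α₂′ β₂′ (suc (suc (suc (suc (suc zero)))))
  rewrite canonical-slot₅ o₁ (not α₂′ xor β₂) α β α₂ β₂ =
  compatible-off-off (not (not α₂′ xor β₂) xor α₂) (not (not α₂′ xor β₂) xor β₂) (not α₂′) (not β₂′)
    (claims-differ₂ β₂ α₂′)

compatible-1 : ∀ α β α₂ β₂ o₁′ α′ β′ α₂′ β₂′ t →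
  compatible (scheduled onAt01 (not α₂′ xor β) false α β α₂ β₂ t)
             (scheduled onAt45 o₁′ false α′ β′ α₂′ β₂′ t) (spineTakes t 1) ≡ true
compatible-1 α β α₂ β₂ o₁′ α′ β′ α₂′ β₂′ zero
  rewrite canonical-slot₂ o₁′ false α′ β′ α₂′ β₂′ = compatible-on-off (o₁′ xor α′) (o₁′ xor β′)
compatible-1 α β α₂ β₂ o₁′ α′ β′ α₂′ β₂′ (suc zero)
  rewrite canonical-slot₃ o₁′ false α′ β′ α₂′ β₂′ = compatible-on-off (not o₁′ xor α′)
    (not o₁′ xor β′)
compatible-1 α β α₂ β₂ o₁′ α′ β′ α₂′ β₂′ (suc (suc zero))
  rewrite canonical-slot₂ (not α₂′ xor β) false α β α₂ β₂ =
  compatible-off-off ((not α₂′ xor β) xor α) ((not α₂′ xor β) xor β) α₂′ β₂′ (claims-differ₁ β α₂′)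
compatible-1 α β α₂ β₂ o₁′ α′ β′ α₂′ β₂′ (suc (suc (suc zero)))
  rewrite canonical-slot₃ (not α₂′ xor β) false α β α₂ β₂ =
  compatible-off-off (not (not α₂′ xor β) xor α) (not (not α₂′ xor β) xor β) (not α₂′) (not β₂′)
    (claims-differ₂ β α₂′)
compatible-1 α β α₂ β₂ o₁′ α′ β′ α₂′ β₂′ (suc (suc (suc (suc zero)))) = compatible-off-on α₂ β₂
compatible-1 α β α₂ β₂ o₁′ α′ β′ α₂′ β₂′ (suc (suc (suc (suc (suc zero))))) =
  compatible-off-on (not α₂) (not β₂)

isEven : ℕ → Bool
isEven zero    = true
isEven (suc m) = not (isEven m)

-- Pieces are numbered 0, ..., n + 2 and described by the canonical-form bits of their covers.
module Schedule (n : ℕ) (α₁ β₁ α₂ β₂ : ℕ → Bool) where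
  open Cyclic n using (next)

  role : ℕ → Role
  role zero          = onAt23
  role (suc zero)    = onAt01
  role (suc (suc r)) = alternating (isEven r)

  orientation : ℕ → Bool
  orientation zero    = false
  orientation (suc r) = not (orientation r xor β₁ (2 + r)) xor α₁ (3 + r)

  o₁ o₂ : ℕ → Bool
  o₁ zero          = not (orientation n xor β₁ (2 + n)) xor α₁ 0
  o₁ (suc zero)    = not (α₂ 2) xor β₁ 1
  o₁ (suc (suc r)) = orientation r
  o₂ zero          = not (α₂ 1) xor β₂ 0
  o₂ (suc _)       = false

  planned : ℕ → Fin 6 → EdgeState
  planned q = scheduled (role q) (o₁ q) (o₂ q) (α₁ q) (β₁ q) (α₂ q) (β₂ q)

  compatible-everywhere : isEven n ≡ true →
    ∀ q t → compatible (planned q t) (planned (next q) t) (spineTakes t q) ≡ true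
  compatible-everywhere even zero          t = compatible-0 _ _ _ _ _ _ _ _ _ _ t
  compatible-everywhere even (suc zero)    t = compatible-1 _ _ _ _ _ _ _ _ _ t
  compatible-everywhere even (suc (suc r)) t with r ≡ᵇ n in e
  ... | false = compatible-inner r (isEven r) _ _ _ _ _ false _ _ _ _ t
  ... | true with ≡ᵇ-sound r n e
  ...   | refl = wrap-around (isEven n) even
    where
    -- The last piece must have role onAt45 to meet piece 0 (role onAt23): here k is odd.
    wrap-around : ∀ e → e ≡ true →
      compatible (scheduled (alternating e) (orientation n) false (α₁ (2 + n)) (β₁ (2 + n))
                   (α₂ (2 + n)) (β₂ (2 + n)) t) (planned 0 t) (spineTakes t (2 + n)) ≡ true
    wrap-around .true refl = compatible-inner n true _ _ _ _ _ (o₂ 0) _ _ _ _ t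

toℕ≡⇒==F : ∀ {m} {a b : Fin m} → toℕ a ≡ toℕ b → ⌊ a ≟ b ⌋ ≡ true
toℕ≡⇒==F e = trans (cong (λ z → ⌊ _ ≟ z ⌋) (sym (toℕ-injective e))) (==F-refl _)

toℕ≢⇒==F-false : ∀ {m} {a b : Fin m} → ¬ toℕ a ≡ toℕ b → ⌊ a ≟ b ⌋ ≡ false
toℕ≢⇒==F-false {a = a} {b} ne = ==F-false a b (λ e → ne (cong toℕ e))

q+2≡2+q : ∀ q → q + 2 ≡ suc (suc q)
q+2≡2+q q = +-comm q 2

q+3≡3+q : ∀ q → q + 3 ≡ suc (suc (suc q))
q+3≡3+q q = +-comm q 3

odd<even : ∀ q m → q ≤ m → isEven m ≡ true → isEven q ≡ false → suc q ≤ m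
odd<even q m le em eq = ≤∧≢⇒< le (λ e → true≢false (trans (sym (trans (cong isEven e) em)) eq))

count-two-doubles : ∀ X Y → (X ≡ true × Y ≡ false) ⊎ (X ≡ false × Y ≡ true) →
  indicator X + (indicator X + (indicator Y + (indicator Y + 0))) ≡ 2
count-two-doubles .true .false (inj₁ (refl , refl)) = refl
count-two-doubles .false .true (inj₂ (refl , refl)) = refl

isEven-pred-even : ∀ q → isEven q ≡ true → ¬ q ≡ 0 → isEven (pred q) ≡ false
isEven-pred-even zero _ h = ⊥-elim (h refl)
isEven-pred-even (suc q) e _ with isEven q
... | false = refl
... | true with e
...   | ()

isEven-pred-odd : ∀ q → isEven q ≡ false → isEven (pred q) ≡ true
isEven-pred-odd zero ()
isEven-pred-odd (suc q) e with isEven q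
... | true = refl
... | false with e
...   | ()

module Spine (n : ℕ) (even : isEven n ≡ true) (P : Fin (3 + n) → Piece) where
  open Construction (3 + n) P
  Vertex = Vtx (3 + n) P

  toℕ≤n : ∀ (j : Fin (suc n)) → toℕ j ≤ n
  toℕ≤n j = ≤-pred (toℕ<n j)

  up down : Fin (suc n) → Fin (suc n)
  up j = fromℕ≤ n (suc (toℕ j))
  down j = fromℕ≤ n (pred (toℕ j))

  last : Fin (suc n)
  last = fromℕ n

  toℕ-up : ∀ j → suc (toℕ j) ≤ n → toℕ (up j) ≡ suc (toℕ j)
  toℕ-up j le = toℕ-fromℕ≤ n (suc (toℕ j)) le

  toℕ-down : ∀ j → toℕ (down j) ≡ pred (toℕ j)
  toℕ-down j = toℕ-fromℕ≤ n (pred (toℕ j)) (≤-trans pred[n]≤n (toℕ≤n j))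

  vMate₂₃′ : Fin (suc n) → Bool → Bool → Vertex
  vMate₂₃′ j true _ = cv (suc zero)
  vMate₂₃′ j false true = vv (down j)
  vMate₂₃′ j false false = vv (up j)

  vMate₄₅′ : Fin (suc n) → Bool → Bool → Vertex
  vMate₄₅′ j true _ = cv zero
  vMate₄₅′ j false true = vv (up j)
  vMate₄₅′ j false false = vv (down j)

  vMate₂₃ vMate₄₅ : Fin (suc n) → Vertex
  vMate₂₃ j = vMate₂₃′ j (toℕ j ≡ᵇ 0) (isEven (toℕ j))
  vMate₄₅ j = vMate₄₅′ j (toℕ j ≡ᵇ n) (isEven (toℕ j))

  -- Rounds 0,1: v_j c_{j+2}.  Rounds 2,3: c_1 v_0, v_1 v_2, ..., v_{n-1} v_n.
  -- Rounds 4,5: v_0 v_1, ..., v_{n-2} v_{n-1}, v_n c_0.  (n is even.)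
  vMate : Fin 6 → Fin (suc n) → Vertex
  vMate zero j = cv (suc (suc j))
  vMate (suc zero) j = cv (suc (suc j))
  vMate (suc (suc zero)) j = vMate₂₃ j
  vMate (suc (suc (suc zero))) j = vMate₂₃ j
  vMate (suc (suc (suc (suc zero)))) j = vMate₄₅ j
  vMate (suc (suc (suc (suc (suc zero))))) j = vMate₄₅ j

  cMate₀₁ : Fin (3 + n) → Fin (suc n)
  cMate₀₁ zero = zero
  cMate₀₁ (suc zero) = zero
  cMate₀₁ (suc (suc j)) = j

  cMate : Fin 6 → Fin (3 + n) → Fin (suc n)
  cMate zero i = cMate₀₁ i
  cMate (suc zero) i = cMate₀₁ i
  cMate (suc (suc zero)) i = zero
  cMate (suc (suc (suc zero))) i = zero
  cMate (suc (suc (suc (suc zero)))) i = last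
  cMate (suc (suc (suc (suc (suc zero))))) i = last

  vMate₂₃-even : ∀ j → ¬ toℕ j ≡ 0 → isEven (toℕ j) ≡ true → vMate₂₃′ j (toℕ j ≡ᵇ 0)
    (isEven (toℕ j)) ≡ vv (down j)
  vMate₂₃-even j ne ee rewrite ≡ᵇ-false ne | ee = refl
  vMate₂₃-odd : ∀ j → isEven (toℕ j) ≡ false → vMate₂₃′ j (toℕ j ≡ᵇ 0) (isEven (toℕ j)) ≡ vv (up j)
  vMate₂₃-odd j eo rewrite ≡ᵇ-false {toℕ j} {0}
    (λ e → true≢false (trans (cong isEven (sym e)) eo)) | eo = refl
  vMate₄₅-last : ∀ j → toℕ j ≡ n → vMate₄₅′ j (toℕ j ≡ᵇ n) (isEven (toℕ j)) ≡ cv zero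
  vMate₄₅-last j e rewrite ≡ᵇ-complete e = refl
  vMate₄₅-even : ∀ j → ¬ toℕ j ≡ n → isEven (toℕ j) ≡ true → vMate₄₅′ j (toℕ j ≡ᵇ n)
    (isEven (toℕ j)) ≡ vv (up j)
  vMate₄₅-even j ne ee rewrite ≡ᵇ-false ne | ee = refl
  vMate₄₅-odd : ∀ j → isEven (toℕ j) ≡ false → vMate₄₅′ j (toℕ j ≡ᵇ n) (isEven (toℕ j)) ≡ vv
    (down j)
  vMate₄₅-odd j eo rewrite ≡ᵇ-false {toℕ j} {n}
    (λ e → true≢false (trans (sym even) (trans (cong isEven (sym e)) eo))) | eo = refl

  vMate-cMate : ∀ t i → spineTakes t (toℕ i) ≡ true → vMate t (cMate t i) ≡ cv i
  vMate-cMate zero (suc (suc i)) e = refl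
  vMate-cMate (suc zero) (suc (suc i)) e = refl
  vMate-cMate (suc (suc zero)) (suc zero) e = refl
  vMate-cMate (suc (suc (suc zero))) (suc zero) e = refl
  vMate-cMate (suc (suc (suc (suc zero)))) zero e = vMate₄₅-last last (toℕ-fromℕ n)
  vMate-cMate (suc (suc (suc (suc (suc zero))))) zero e = vMate₄₅-last last (toℕ-fromℕ n)
  vMate-cMate zero zero ()
  vMate-cMate zero (suc zero) ()
  vMate-cMate (suc zero) zero ()
  vMate-cMate (suc zero) (suc zero) ()
  vMate-cMate (suc (suc zero)) zero ()
  vMate-cMate (suc (suc zero)) (suc (suc i)) ()
  vMate-cMate (suc (suc (suc zero))) zero ()
  vMate-cMate (suc (suc (suc zero))) (suc (suc i)) ()
  vMate-cMate (suc (suc (suc (suc zero)))) (suc zero) ()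
  vMate-cMate (suc (suc (suc (suc zero)))) (suc (suc i)) ()
  vMate-cMate (suc (suc (suc (suc (suc zero))))) (suc zero) ()
  vMate-cMate (suc (suc (suc (suc (suc zero))))) (suc (suc i)) ()

  data VMateCase (t : Fin 6) (j : Fin (suc n)) : Set where
    viaC : ∀ i → vMate t j ≡ cv i → spineTakes t (toℕ i) ≡ true → cMate t i ≡ j → VMateCase t j
    viaV : ∀ j' → vMate t j ≡ vv j' → vMate t j' ≡ vv j → VMateCase t j

  Consecutive : Fin (suc n) → Fin (suc n) → Set
  Consecutive j j' = toℕ j' ≡ suc (toℕ j) ⊎ suc (toℕ j') ≡ toℕ j

  vMate₂₃-cases : ∀ j → (toℕ j ≡ 0 × vMate₂₃ j ≡ cv (suc zero)) ⊎ Σ (Fin (suc n))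
    (λ j' → vMate₂₃ j ≡ vv j' × vMate₂₃ j' ≡ vv j × Consecutive j j')
  vMate₂₃-cases j with toℕ j ≡ᵇ 0 in ez | isEven (toℕ j) in ee
  ... | true | _ = inj₁ (≡ᵇ-sound _ _ ez , refl)
  ... | false | true = inj₂
    (down j , refl , trans (vMate₂₃-odd (down j) ed) (cong vv (toℕ-injective ud)) , inj₂
    (trans (cong suc (toℕ-down j)) ps))
    where
    nz : ¬ toℕ j ≡ 0
    nz e = true≢false (trans (sym (≡ᵇ-complete e)) ez)
    ps : suc (pred (toℕ j)) ≡ toℕ j
    ps = suc-pred-≢0 nz
    ed : isEven (toℕ (down j)) ≡ false
    ed = trans (cong isEven (toℕ-down j)) (isEven-pred-even (toℕ j) ee nz)
    ud : toℕ (up (down j)) ≡ toℕ j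
    ud = trans (toℕ-up (down j) (subst (_≤ n) (sym (trans (cong suc (toℕ-down j)) ps)) (toℕ≤n j)))
               (trans (cong suc (toℕ-down j)) ps)
  ... | false | false = inj₂
    (up j , refl , trans (vMate₂₃-even (up j) nz' eu) (cong vv (toℕ-injective du)) , inj₁ ut)
    where
    lt : suc (toℕ j) ≤ n
    lt = odd<even (toℕ j) n (toℕ≤n j) even ee
    ut = toℕ-up j lt
    nz' : ¬ toℕ (up j) ≡ 0
    nz' e with trans (sym ut) e
    ... | ()
    eu : isEven (toℕ (up j)) ≡ true
    eu rewrite ut | ee = refl
    du : toℕ (down (up j)) ≡ toℕ j
    du = trans (toℕ-down (up j)) (cong pred ut)

  vMate₄₅-cases : ∀ j → (toℕ j ≡ n × vMate₄₅ j ≡ cv zero) ⊎ Σ (Fin (suc n))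
    (λ j' → vMate₄₅ j ≡ vv j' × vMate₄₅ j' ≡ vv j × Consecutive j j')
  vMate₄₅-cases j with toℕ j ≡ᵇ n in el | isEven (toℕ j) in ee
  ... | true | _ = inj₁ (≡ᵇ-sound _ _ el , refl)
  ... | false | true = inj₂
    (up j , refl , trans (vMate₄₅-odd (up j) eu) (cong vv (toℕ-injective du)) , inj₁ ut)
    where
    nl : ¬ toℕ j ≡ n
    nl e = true≢false (trans (sym (≡ᵇ-complete e)) el)
    lt : suc (toℕ j) ≤ n
    lt = ≤∧≢⇒< (toℕ≤n j) nl
    ut = toℕ-up j lt
    eu : isEven (toℕ (up j)) ≡ false
    eu rewrite ut | ee = refl
    du : toℕ (down (up j)) ≡ toℕ j
    du = trans (toℕ-down (up j)) (cong pred ut)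
  ... | false | false = inj₂
    (down j , refl , trans (vMate₄₅-even (down j) nl' ed) (cong vv (toℕ-injective ud)) , inj₂
    (trans (cong suc (toℕ-down j)) ps))
    where
    nz : ¬ toℕ j ≡ 0
    nz e = true≢false (trans (cong isEven (sym e)) ee)
    ps : suc (pred (toℕ j)) ≡ toℕ j
    ps = suc-pred-≢0 nz
    ed : isEven (toℕ (down j)) ≡ true
    ed = trans (cong isEven (toℕ-down j)) (isEven-pred-odd (toℕ j) ee)
    nl' : ¬ toℕ (down j) ≡ n
    nl' e = 1+n≰n
      (subst (λ z → suc z ≤ n) (trans (sym (toℕ-down j)) e) (subst (_≤ n) (sym ps) (toℕ≤n j)))
    ud : toℕ (up (down j)) ≡ toℕ j
    ud = trans (toℕ-up (down j) (subst (_≤ n) (sym (trans (cong suc (toℕ-down j)) ps)) (toℕ≤n j)))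
               (trans (cong suc (toℕ-down j)) ps)

  vMate-cases : ∀ t j → VMateCase t j
  vMate-cases zero j = viaC (suc (suc j)) refl refl refl
  vMate-cases (suc zero) j = viaC (suc (suc j)) refl refl refl
  vMate-cases (suc (suc zero)) j with vMate₂₃-cases j
  ... | inj₁ (e , eq) = viaC (suc zero) eq refl (toℕ-injective (sym e))
  ... | inj₂ (j' , e1 , e2 , _) = viaV j' e1 e2
  vMate-cases (suc (suc (suc zero))) j with vMate₂₃-cases j
  ... | inj₁ (e , eq) = viaC (suc zero) eq refl (toℕ-injective (sym e))
  ... | inj₂ (j' , e1 , e2 , _) = viaV j' e1 e2
  vMate-cases (suc (suc (suc (suc zero)))) j with vMate₄₅-cases j
  ... | inj₁ (e , eq) = viaC zero eq refl (toℕ-injective (trans (toℕ-fromℕ n) (sym e)))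
  ... | inj₂ (j' , e1 , e2 , _) = viaV j' e1 e2
  vMate-cases (suc (suc (suc (suc (suc zero))))) j with vMate₄₅-cases j
  ... | inj₁ (e , eq) = viaC zero eq refl (toℕ-injective (trans (toℕ-fromℕ n) (sym e)))
  ... | inj₂ (j' , e1 , e2 , _) = viaV j' e1 e2

  last-adjacent-c₀ : (toℕ (fromℕ n) + 3 ≡ᵇ suc (suc (suc n))) ≡ true
  last-adjacent-c₀ = ≡ᵇ-complete (trans (cong (_+ 3) (toℕ-fromℕ n)) (q+3≡3+q n))

  adj-cMate : ∀ t i → spineTakes t (toℕ i) ≡ true → adjV (cv i) (vv (cMate t i)) ≡ true
  adj-cMate zero (suc (suc i)) e = ∨-introˡ (≡ᵇ-complete (sym (q+2≡2+q (toℕ i))))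
  adj-cMate (suc zero) (suc (suc i)) e = ∨-introˡ (≡ᵇ-complete (sym (q+2≡2+q (toℕ i))))
  adj-cMate (suc (suc zero)) (suc zero) e = refl
  adj-cMate (suc (suc (suc zero))) (suc zero) e = refl
  adj-cMate (suc (suc (suc (suc zero)))) zero e = ∨-introˡ (∨-introˡ last-adjacent-c₀)
  adj-cMate (suc (suc (suc (suc (suc zero))))) zero e = ∨-introˡ (∨-introˡ last-adjacent-c₀)
  adj-cMate zero zero ()
  adj-cMate zero (suc zero) ()
  adj-cMate (suc zero) zero ()
  adj-cMate (suc zero) (suc zero) ()
  adj-cMate (suc (suc zero)) zero ()
  adj-cMate (suc (suc zero)) (suc (suc i)) ()
  adj-cMate (suc (suc (suc zero))) zero ()
  adj-cMate (suc (suc (suc zero))) (suc (suc i)) ()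
  adj-cMate (suc (suc (suc (suc zero)))) (suc zero) ()
  adj-cMate (suc (suc (suc (suc zero)))) (suc (suc i)) ()
  adj-cMate (suc (suc (suc (suc (suc zero))))) (suc zero) ()
  adj-cMate (suc (suc (suc (suc (suc zero))))) (suc (suc i)) ()

  adj-consecutive : ∀ j j' → Consecutive j j' → adjV (vv j) (vv j') ≡ true
  adj-consecutive j j' (inj₁ e) = ∨-introˡ (≡ᵇ-complete (sym e))
  adj-consecutive j j' (inj₂ e) = ∨-introʳ (suc (toℕ j) ≡ᵇ toℕ j') (≡ᵇ-complete e)

  adj-c₁ : ∀ j → toℕ j ≡ 0 → adjV (vv j) (cv (suc zero)) ≡ true
  adj-c₁ j e = ∨-introˡ (≡ᵇ-complete e)

  adj-c₀ : ∀ j → toℕ j ≡ n → adjV (vv j) (cv zero) ≡ true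
  adj-c₀ j e = ∨-introˡ ((≡ᵇ-complete (trans (q+3≡3+q (toℕ j)) (cong (λ z → suc (suc (suc z))) e))))

  adj-along : ∀ {u w w′ : Vertex} → w′ ≡ w → adjV u w ≡ true → adjV u w′ ≡ true
  adj-along {u} e a = subst (λ z → adjV u z ≡ true) (sym e) a

  adj-vMate : ∀ t j → adjV (vv j) (vMate t j) ≡ true
  adj-vMate zero j = ≡ᵇ-complete (sym (q+2≡2+q (toℕ j)))
  adj-vMate (suc zero) j = ≡ᵇ-complete (sym (q+2≡2+q (toℕ j)))
  adj-vMate (suc (suc zero)) j with vMate₂₃-cases j
  ... | inj₁ (e , eq) = adj-along eq (adj-c₁ j e)
  ... | inj₂ (j' , e1 , _ , r) = adj-along e1 (adj-consecutive j j' r)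
  adj-vMate (suc (suc (suc zero))) j with vMate₂₃-cases j
  ... | inj₁ (e , eq) = adj-along eq (adj-c₁ j e)
  ... | inj₂ (j' , e1 , _ , r) = adj-along e1 (adj-consecutive j j' r)
  adj-vMate (suc (suc (suc (suc zero)))) j with vMate₄₅-cases j
  ... | inj₁ (e , eq) = adj-along eq (adj-c₀ j e)
  ... | inj₂ (j' , e1 , _ , r) = adj-along e1 (adj-consecutive j j' r)
  adj-vMate (suc (suc (suc (suc (suc zero))))) j with vMate₄₅-cases j
  ... | inj₁ (e , eq) = adj-along eq (adj-c₀ j e)
  ... | inj₂ (j' , e1 , _ , r) = adj-along e1 (adj-consecutive j j' r)

  count-double : ∀ Y → Y ≡ true → indicator Y + (indicator Y + 0) ≡ 2
  count-double .true refl = refl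

  0≢ᵇ2+ : ∀ q → (0 ≡ᵇ q + 2) ≡ false
  0≢ᵇ2+ q rewrite q+2≡2+q q = refl
  1≢ᵇ2+ : ∀ q → (1 ≡ᵇ q + 2) ≡ false
  1≢ᵇ2+ q rewrite q+2≡2+q q = refl

  +3-injective : ∀ a b → a + 3 ≡ suc (suc (suc b)) → a ≡ b
  +3-injective a b e = suc-injective (suc-injective (suc-injective (trans (sym (q+3≡3+q a)) e)))
  +2-injective : ∀ a b → suc (suc a) ≡ b + 2 → b ≡ a
  +2-injective a b e = suc-injective (suc-injective (trans (sym (q+2≡2+q b)) (sym e)))

  count-cMate : ∀ i j → E (cv i) (vv j) ≡ true → countB {6}
    (λ t → spineTakes t (toℕ i) ∧ _==ᵛ_ {3 + n} {P} (vv (cMate t i)) (vv j)) ≡ 2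
  count-cMate zero j e = count-double ⌊ last ≟ j ⌋
    (toℕ≡⇒==F {a = last} {b = j}
    (trans (toℕ-fromℕ n) (sym (+3-injective _ _ (≡ᵇ-sound _ _ (∨-resolveˡ _ e (0≢ᵇ2+ (toℕ j))))))))
  count-cMate (suc zero) j e = count-double ⌊ zero ≟ j ⌋
    (toℕ≡⇒==F {a = zero} {b = j} (sym (≡ᵇ-sound _ _ (∨-resolveˡ _ e (1≢ᵇ2+ (toℕ j))))))
  count-cMate (suc (suc i)) j e = count-double ⌊ i ≟ j ⌋
    (toℕ≡⇒==F {a = i} {b = j} (sym (+2-injective _ _ (≡ᵇ-sound _ _ e))))

  n≢2+n : ∀ (m : ℕ) → ¬ m ≡ suc (suc m)
  n≢2+n zero ()
  n≢2+n (suc m) e = n≢2+n m (suc-injective e)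

  pred≢suc : ∀ (q : ℕ) → ¬ pred q ≡ suc q
  pred≢suc zero ()
  pred≢suc (suc q) e = n≢2+n q e

  count-vMate : ∀ j j' → E (vv j) (vv j') ≡ true → countB (λ t → vMate t j ==ᵛ vv j') ≡ 2
  count-vMate j j' e = go (isEven (toℕ j)) refl
    where
    e' : toℕ j' ≡ suc (toℕ j)
    e' = sym (≡ᵇ-sound _ _ e)
    lt : suc (toℕ j) ≤ n
    lt = subst (_≤ n) e' (toℕ≤n j')
    go : ∀ b → isEven (toℕ j) ≡ b → countB (λ t → vMate t j ==ᵛ vv j') ≡ 2
    go true ee = count-two-doubles (vMate₂₃ j ==ᵛ vv j') (vMate₄₅ j ==ᵛ vv j') (inj₂ (X , Y))
      where
      X : (vMate₂₃ j ==ᵛ vv j') ≡ false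
      X with toℕ j ≡ᵇ 0 in ez
      ... | true = refl
      ... | false rewrite ee = toℕ≢⇒==F-false
        (λ q → pred≢suc (toℕ j) (trans (sym (toℕ-down j)) (trans q e')))
      ne : ¬ toℕ j ≡ n
      ne q = 1+n≰n (subst (λ z → suc z ≤ n) q lt)
      Y : (vMate₄₅ j ==ᵛ vv j') ≡ true
      Y = trans (cong (_==ᵛ vv j') (vMate₄₅-even j ne ee)) (toℕ≡⇒==F (trans (toℕ-up j lt) (sym e')))
    go false ee = count-two-doubles (vMate₂₃ j ==ᵛ vv j') (vMate₄₅ j ==ᵛ vv j') (inj₁ (X , Y))
      where
      X : (vMate₂₃ j ==ᵛ vv j') ≡ true
      X = trans (cong (_==ᵛ vv j') (vMate₂₃-odd j ee)) (toℕ≡⇒==F (trans (toℕ-up j lt) (sym e')))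
      Y : (vMate₄₅ j ==ᵛ vv j') ≡ false
      Y = trans (cong (_==ᵛ vv j') (vMate₄₅-odd j ee))
        (toℕ≢⇒==F-false (λ q → pred≢suc (toℕ j) (trans (sym (toℕ-down j)) (trans q e'))))


nand-elimˡ : ∀ {a b} → not (a ∧ b) ≡ true → a ≡ true → b ≡ false
nand-elimˡ {true}  {false} _  _  = refl
nand-elimˡ {true}  {true}  () _
nand-elimˡ {false}         _  ()

nand-elimʳ : ∀ {a b} → not (a ∧ b) ≡ true → b ≡ true → a ≡ false
nand-elimʳ {false}        _  _  = refl
nand-elimʳ {true} {true}  () _
nand-elimʳ {true} {false} _  ()

nor-elimˡ : ∀ {a b} → not (a ∨ b) ≡ true → a ≡ false
nor-elimˡ {false} _  = refl
nor-elimˡ {true}  ()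

nor-elimʳ : ∀ {a b} → not (a ∨ b) ≡ true → b ≡ false
nor-elimʳ {false} e  = trans (sym (not-involutive _)) (cong not e)
nor-elimʳ {true}  ()

nor-intro : ∀ {a b} → a ≡ false → b ≡ false → not (a ∨ b) ≡ true
nor-intro refl refl = refl

nor-falseˡ : ∀ {a} b → a ≡ true → not (a ∨ b) ≡ false
nor-falseˡ b refl = refl

nor-falseʳ : ∀ a {b} → b ≡ true → not (a ∨ b) ≡ false
nor-falseʳ a refl = cong not (∨-zeroʳ a)

not-true : ∀ {a} → not a ≡ true → a ≡ false
not-true {false} _  = refl
not-true {true}  ()

neither⇒true : ∀ {a b d} → (not a ∧ not b) ≡ d → a ≡ false → b ≡ false → d ≡ true
neither⇒true {false} {false} e _ _ = sym e

neither-elim : ∀ {a b} → (not a ∧ not b) ≡ true → a ≡ false × b ≡ false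
neither-elim {false} {false} _ = refl , refl

neither-falseˡ : ∀ {a b d} → (not a ∧ not b) ≡ d → a ≡ true → d ≡ false
neither-falseˡ {true} e _ = sym e

neither-falseʳ : ∀ {a b d} → (not a ∧ not b) ≡ d → b ≡ true → d ≡ false
neither-falseʳ {true}          e _ = sym e
neither-falseʳ {false} {true} e _ = sym e

record CompatibleFacts (sY sX : EdgeState) (d : Bool) : Set where
  field
    a-claimed-once  : not (atY⁰ sY ∧ atX⁰ sX) ≡ true
    b-claimed-once  : not (atY¹ sY ∧ atX¹ sX) ≡ true
    a-or-b-claimed  : not (aFree sY sX ∧ bFree sY sX) ≡ true
    spine-iff-both-claimed : (not (aFree sY sX) ∧ not (bFree sY sX)) ≡ d

compatible-facts : ∀ sY sX d → compatible sY sX d ≡ true → CompatibleFacts sY sX d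
compatible-facts sY sX d e = record
  { a-claimed-once = ∧-conicalˡ _ _ e
  ; b-claimed-once = ∧-conicalˡ _ _ e₁
  ; a-or-b-claimed = ∧-conicalˡ _ _ e₂
  ; spine-iff-both-claimed = ==ᵇ-sound _ _ (∧-conicalʳ (not (aFree sY sX ∧ bFree sY sX)) _ e₂)
  }
  where
  e₁ = ∧-conicalʳ (not (atY⁰ sY ∧ atX⁰ sX)) _ e
  e₂ = ∧-conicalʳ (not (atY¹ sY ∧ atX¹ sX)) _ e₁

isEven-%2 : ∀ m → isEven m ≡ (m % 2 ≡ᵇ 0)
isEven-%2 zero          = refl
isEven-%2 (suc zero)    = refl
isEven-%2 (suc (suc m)) =
  trans (not-involutive (isEven m)) (trans (isEven-%2 m) (cong (_≡ᵇ 0) (sym (m+2%2≡m%2))))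
  where
  m+2%2≡m%2 : suc (suc m) % 2 ≡ m % 2
  m+2%2≡m%2 = trans (%-congˡ (+-comm 2 m)) ([m+n]%n≡m%n m 2)

module Assembly (n : ℕ) (even : isEven n ≡ true) (P : Fin (3 + n) → Piece)
  (VP : ∀ i → ValidPiece (P i)) where
  open Cyclic n
  open Construction K P
  open Spine n even P public
  module PA (i : Fin K) = CoverAtEdge (P i) (VP i)

  sorting : (i : Fin K) → Sorted (PA.state i)
  sorting i = PA.sorted-states i

  α₁ᶠ β₁ᶠ α₂ᶠ β₂ᶠ : Fin K → Bool
  α₁ᶠ i = Sorted.α₁ (sorting i)
  β₁ᶠ i = Sorted.β₁ (sorting i)
  α₂ᶠ i = Sorted.α₂ (sorting i)
  β₂ᶠ i = Sorted.β₂ (sorting i)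

  α₁ⁿ β₁ⁿ α₂ⁿ β₂ⁿ : ℕ → Bool
  α₁ⁿ q = α₁ᶠ (toPiece q)
  β₁ⁿ q = β₁ᶠ (toPiece q)
  α₂ⁿ q = α₂ᶠ (toPiece q)
  β₂ⁿ q = β₂ᶠ (toPiece q)

  open Schedule n α₁ⁿ β₁ⁿ α₂ⁿ β₂ⁿ public

  pieceRole : Fin K → Role
  pieceRole i = role (toℕ i)
  pieceO₁ pieceO₂ : Fin K → Bool
  pieceO₁ i = o₁ (toℕ i)
  pieceO₂ i = o₂ (toℕ i)

  pick pick⁻¹ : Fin K → Fin 6 → Fin 6
  pick i t = Sorted.order (sorting i) (slotOf (pieceRole i) (pieceO₁ i) (pieceO₂ i) t)
  pick⁻¹ i s = slotOf⁻¹ (pieceRole i) (pieceO₁ i) (pieceO₂ i) (Sorted.order⁻¹ (sorting i) s)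

  pick⁻¹-pick : ∀ i t → pick⁻¹ i (pick i t) ≡ t
  pick⁻¹-pick i t rewrite Sorted.order⁻¹-order (sorting i)
    (slotOf (pieceRole i) (pieceO₁ i) (pieceO₂ i) t) = slotOf⁻¹-slotOf (pieceRole i) (pieceO₁ i)
    (pieceO₂ i) t

  pick-pick⁻¹ : ∀ i s → pick i (pick⁻¹ i s) ≡ s
  pick-pick⁻¹ i s rewrite slotOf-slotOf⁻¹ (pieceRole i) (pieceO₁ i) (pieceO₂ i)
    (Sorted.order⁻¹ (sorting i) s) = Sorted.order-order⁻¹ (sorting i) s

  stateIn : Fin K → Fin 6 → EdgeState
  stateIn i t = PA.state i (pick i t)

  sorted-slot : ∀ i s → PA.state i (Sorted.order (sorting i) s) ≡ canonical (α₁ᶠ i) (β₁ᶠ i) (α₂ᶠ i)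
    (β₂ᶠ i) s
  sorted-slot i = Sorted.sorted (sorting i)

  stateIn-planned : ∀ i t → stateIn i t ≡ planned (toℕ i) t
  stateIn-planned i t = trans (sorted-slot i _)
    (cong (λ z → canonical (α₁ᶠ z) (β₁ᶠ z) (α₂ᶠ z) (β₂ᶠ z)
    (slotOf (pieceRole i) (pieceO₁ i) (pieceO₂ i) t))
                                    (sym (fromℕ≤-toℕ (suc (suc n)) i)))

  junction-compatible : ∀ i t → compatible (stateIn i t) (stateIn (nextPiece i) t)
    (spineTakes t (toℕ i)) ≡ true
  junction-compatible i t =
    subst₂ (λ sY sX → compatible sY sX (spineTakes t (toℕ i)) ≡ true)
      (sym (stateIn-planned i t))
      (sym (trans (stateIn-planned (nextPiece i) t) (cong (λ q → planned q t) (toℕ-nextPiece i))))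
      (compatible-everywhere even (toℕ i) t)

  partnerAtX partnerAtY : Fin K → Bool → Vertex
  partnerAtX i true = av (prevPiece i)
  partnerAtX i false = bv (prevPiece i)
  partnerAtY i true = av i
  partnerAtY i false = bv i

  partnerH : ∀ (i : Fin K) (j : Fin (PA.m i)) (w : Fin (2 + PA.m i)) → PA.View i w → Vertex
  partnerH i j w (PA.isX _) = partnerAtX i ⌊ PA.emb i j ≟ PA.x0 i ⌋
  partnerH i j w (PA.isY _) = partnerAtY i ⌊ PA.emb i j ≟ PA.y0 i ⌋
  partnerH i j w (PA.isH j' _) = hv i j'

  mateIn : Fin 6 → (i : Fin K) → Fin (PA.m i) → Fin (2 + PA.m i)
  mateIn t i j = PA.mate i (pick i t) (PA.emb i j)

  partnerA partnerB : Fin K → Bool → Bool → Vertex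
  partnerA i true _ = hv i (PA.hy0 i)
  partnerA i false true = hv (nextPiece i) (PA.hx0 (nextPiece i))
  partnerA i false false = cv i
  partnerB i true _ = hv i (PA.hy1 i)
  partnerB i false true = hv (nextPiece i) (PA.hx1 (nextPiece i))
  partnerB i false false = cv i

  partnerC : Fin 6 → Fin K → Bool → Bool → Vertex
  partnerC t i true _ = av i
  partnerC t i false true = bv i
  partnerC t i false false = vv (cMate t i)

  -- The matching of round t, as an involution on the vertices of H.
  partner : Fin 6 → Vertex → Vertex
  partner t (hv i j) = partnerH i j (mateIn t i j) (PA.view i (mateIn t i j))
  partner t (av i) = partnerA i (atY⁰ (stateIn i t)) (atX⁰ (stateIn (nextPiece i) t))
  partner t (bv i) = partnerB i (atY¹ (stateIn i t)) (atX¹ (stateIn (nextPiece i) t))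
  partner t (cv i) = partnerC t i (aFree (stateIn i t) (stateIn (nextPiece i) t))
    (bFree (stateIn i t) (stateIn (nextPiece i) t))
  partner t (vv j) = vMate t j

  partner-a : ∀ t i b1 b2 → atY⁰ (stateIn i t) ≡ b1 → atX⁰ (stateIn (nextPiece i) t) ≡ b2
    → partner t (av i) ≡ partnerA i b1 b2
  partner-a t i _ _ refl refl = refl
  partner-b : ∀ t i b1 b2 → atY¹ (stateIn i t) ≡ b1 → atX¹ (stateIn (nextPiece i) t) ≡ b2
    → partner t (bv i) ≡ partnerB i b1 b2
  partner-b t i _ _ refl refl = refl
  partner-c : ∀ t i b1 b2 → aFree (stateIn i t) (stateIn (nextPiece i) t) ≡ b1 → bFree (stateIn i t)
    (stateIn (nextPiece i) t) ≡ b2 → partner t (cv i) ≡ partnerC t i b1 b2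
  partner-c t i _ _ refl refl = refl

  module _ (i : Fin K) (t : Fin 6) where
    private
      s = pick i t
      L = PA.reading i s
    atX⁰⇒M : atX⁰ (stateIn i t) ≡ true → PA.M i s (PA.x i) (PA.x0 i) ≡ true
    atX⁰⇒M e = trans (sym (CoverAtEdge.Reading.reads-x⁰ L)) e
    atX¹⇒M : atX¹ (stateIn i t) ≡ true → PA.M i s (PA.x i) (PA.x1 i) ≡ true
    atX¹⇒M e = trans (sym (CoverAtEdge.Reading.reads-x¹ L)) e
    atY⁰⇒M : atY⁰ (stateIn i t) ≡ true → PA.M i s (PA.y i) (PA.y0 i) ≡ true
    atY⁰⇒M e = trans (sym (CoverAtEdge.Reading.reads-y⁰ L)) e
    atY¹⇒M : atY¹ (stateIn i t) ≡ true → PA.M i s (PA.y i) (PA.y1 i) ≡ true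
    atY¹⇒M e = trans (sym (CoverAtEdge.Reading.reads-y¹ L)) e
    M⇒atX⁰ : PA.M i s (PA.x i) (PA.x0 i) ≡ true → atX⁰ (stateIn i t) ≡ true
    M⇒atX⁰ e = trans (CoverAtEdge.Reading.reads-x⁰ L) e
    M⇒atX¹ : PA.M i s (PA.x i) (PA.x1 i) ≡ true → atX¹ (stateIn i t) ≡ true
    M⇒atX¹ e = trans (CoverAtEdge.Reading.reads-x¹ L) e
    M⇒atY⁰ : PA.M i s (PA.y i) (PA.y0 i) ≡ true → atY⁰ (stateIn i t) ≡ true
    M⇒atY⁰ e = trans (CoverAtEdge.Reading.reads-y⁰ L) e
    M⇒atY¹ : PA.M i s (PA.y i) (PA.y1 i) ≡ true → atY¹ (stateIn i t) ≡ true
    M⇒atY¹ e = trans (CoverAtEdge.Reading.reads-y¹ L) e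

  junction-facts : ∀ i t → CompatibleFacts (stateIn i t) (stateIn (nextPiece i) t)
    (spineTakes t (toℕ i))
  junction-facts i t = compatible-facts _ _ _ (junction-compatible i t)

  mate-of : ∀ i s u v → PA.M i s u v ≡ true → PA.mate i s v ≡ u
  mate-of i s u v e = sym (PA.mate-unique i s v u (trans (PA.M-sym i s v u) e))

  AtXSide AtYSide : ∀ (i : Fin K) (s : Fin 6) (j : Fin (PA.m i)) → Set
  AtXSide i s j = (PA.emb i j ≡ PA.x0 i × PA.M i s (PA.x i) (PA.x0 i) ≡ true)
                ⊎ (PA.emb i j ≡ PA.x1 i × PA.M i s (PA.x i) (PA.x1 i) ≡ true)
  AtYSide i s j = (PA.emb i j ≡ PA.y0 i × PA.M i s (PA.y i) (PA.y0 i) ≡ true)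
                ⊎ (PA.emb i j ≡ PA.y1 i × PA.M i s (PA.y i) (PA.y1 i) ≡ true)

  mate-at-x : ∀ i s j → PA.mate i s (PA.emb i j) ≡ PA.x i → AtXSide i s j
  mate-at-x i s j e = classify (PA.neighbours-x i (PA.emb i j) (PA.M⊆G i s _ _ x-emb))
    where
    x-emb : PA.M i s (PA.x i) (PA.emb i j) ≡ true
    x-emb = trans (PA.M-sym i s _ _) (PA.M-at-mate i s (PA.emb i j) (sym e))
    classify : PA.emb i j ≡ PA.y i ⊎ PA.emb i j ≡ PA.x0 i ⊎ PA.emb i j ≡ PA.x1 i → AtXSide i s j
    classify (inj₁ q)        = ⊥-elim (PA.emb≢y i j q)
    classify (inj₂ (inj₁ q)) = inj₁ (q , subst (λ v → PA.M i s (PA.x i) v ≡ true) q x-emb)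
    classify (inj₂ (inj₂ q)) = inj₂ (q , subst (λ v → PA.M i s (PA.x i) v ≡ true) q x-emb)

  mate-at-y : ∀ i s j → PA.mate i s (PA.emb i j) ≡ PA.y i → AtYSide i s j
  mate-at-y i s j e = classify (PA.neighbours-y i (PA.emb i j) (PA.M⊆G i s _ _ y-emb))
    where
    y-emb : PA.M i s (PA.y i) (PA.emb i j) ≡ true
    y-emb = trans (PA.M-sym i s _ _) (PA.M-at-mate i s (PA.emb i j) (sym e))
    classify : PA.emb i j ≡ PA.x i ⊎ PA.emb i j ≡ PA.y0 i ⊎ PA.emb i j ≡ PA.y1 i → AtYSide i s j
    classify (inj₁ q)        = ⊥-elim (PA.emb≢x i j q)
    classify (inj₂ (inj₁ q)) = inj₁ (q , subst (λ v → PA.M i s (PA.y i) v ≡ true) q y-emb)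
    classify (inj₂ (inj₂ q)) = inj₂ (q , subst (λ v → PA.M i s (PA.y i) v ≡ true) q y-emb)

  partnerH-h : ∀ i j' w (v : PA.View i w) j → w ≡ PA.emb i j → partnerH i j' w v ≡ hv i j
  partnerH-h i j' w (PA.isX e) j q = ⊥-elim (PA.emb≢x i j (trans (sym q) e))
  partnerH-h i j' w (PA.isY e) j q = ⊥-elim (PA.emb≢y i j (trans (sym q) e))
  partnerH-h i j' w (PA.isH j'' e) j q = cong (hv i) (PA.emb-injective i j'' j (trans e q))

  partnerH-x0 : ∀ i j w (v : PA.View i w) → w ≡ PA.x i → PA.emb i j ≡ PA.x0 i
    → partnerH i j w v ≡ av (prevPiece i)
  partnerH-x0 i j w (PA.isX e) q r = cong (partnerAtX i)
    (trans (cong (λ z → ⌊ z ≟ PA.x0 i ⌋) r) (==F-refl _))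
  partnerH-x0 i j w (PA.isY e) q r = ⊥-elim (PA.x≢y i (trans (sym q) e))
  partnerH-x0 i j w (PA.isH j'' e) q r = ⊥-elim (PA.emb≢x i j'' (trans e q))

  partnerH-x1 : ∀ i j w (v : PA.View i w) → w ≡ PA.x i → PA.emb i j ≡ PA.x1 i
    → partnerH i j w v ≡ bv (prevPiece i)
  partnerH-x1 i j w (PA.isX e) q r = cong (partnerAtX i)
    (==F-false _ _ (λ z → PA.x0≢x1 i (trans (sym z) r)))
  partnerH-x1 i j w (PA.isY e) q r = ⊥-elim (PA.x≢y i (trans (sym q) e))
  partnerH-x1 i j w (PA.isH j'' e) q r = ⊥-elim (PA.emb≢x i j'' (trans e q))

  partnerH-y0 : ∀ i j w (v : PA.View i w) → w ≡ PA.y i → PA.emb i j ≡ PA.y0 i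
    → partnerH i j w v ≡ av i
  partnerH-y0 i j w (PA.isX e) q r = ⊥-elim (PA.x≢y i (trans (sym e) q))
  partnerH-y0 i j w (PA.isY e) q r = cong (partnerAtY i)
    (trans (cong (λ z → ⌊ z ≟ PA.y0 i ⌋) r) (==F-refl _))
  partnerH-y0 i j w (PA.isH j'' e) q r = ⊥-elim (PA.emb≢y i j'' (trans e q))

  partnerH-y1 : ∀ i j w (v : PA.View i w) → w ≡ PA.y i → PA.emb i j ≡ PA.y1 i
    → partnerH i j w v ≡ bv i
  partnerH-y1 i j w (PA.isX e) q r = ⊥-elim (PA.x≢y i (trans (sym e) q))
  partnerH-y1 i j w (PA.isY e) q r = cong (partnerAtY i)
    (==F-false _ _ (λ z → PA.y0≢y1 i (trans (sym z) r)))
  partnerH-y1 i j w (PA.isH j'' e) q r = ⊥-elim (PA.emb≢y i j'' (trans e q))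

  partner-h-h : ∀ t i j' j → mateIn t i j' ≡ PA.emb i j → partner t (hv i j') ≡ hv i j
  partner-h-h t i j' j q = partnerH-h i j' _ (PA.view i (mateIn t i j')) j q
  partner-h-x0 : ∀ t i j → mateIn t i j ≡ PA.x i → PA.emb i j ≡ PA.x0 i → partner t (hv i j) ≡ av
    (prevPiece i)
  partner-h-x0 t i j q r = partnerH-x0 i j _ (PA.view i (mateIn t i j)) q r
  partner-h-x1 : ∀ t i j → mateIn t i j ≡ PA.x i → PA.emb i j ≡ PA.x1 i → partner t (hv i j) ≡ bv
    (prevPiece i)
  partner-h-x1 t i j q r = partnerH-x1 i j _ (PA.view i (mateIn t i j)) q r
  partner-h-y0 : ∀ t i j → mateIn t i j ≡ PA.y i → PA.emb i j ≡ PA.y0 i → partner t (hv i j) ≡ av i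
  partner-h-y0 t i j q r = partnerH-y0 i j _ (PA.view i (mateIn t i j)) q r
  partner-h-y1 : ∀ t i j → mateIn t i j ≡ PA.y i → PA.emb i j ≡ PA.y1 i → partner t (hv i j) ≡ bv i
  partner-h-y1 t i j q r = partnerH-y1 i j _ (PA.view i (mateIn t i j)) q r

  hv-hx0-cong : ∀ {i i'} → i' ≡ i → hv {K} {P} i' (PA.hx0 i') ≡ hv i (PA.hx0 i)
  hv-hx0-cong refl = refl
  hv-hx1-cong : ∀ {i i'} → i' ≡ i → hv {K} {P} i' (PA.hx1 i') ≡ hv i (PA.hx1 i)
  hv-hx1-cong refl = refl

  emb-hx0 : ∀ i → PA.emb i (PA.hx0 i) ≡ PA.x0 i
  emb-hx0 i = PA.emb-emb⁻¹ i (PA.x0 i) (PA.x0≢x i) (PA.x0≢y i)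
  emb-hx1 : ∀ i → PA.emb i (PA.hx1 i) ≡ PA.x1 i
  emb-hx1 i = PA.emb-emb⁻¹ i (PA.x1 i) (PA.x1≢x i) (PA.x1≢y i)
  emb-hy0 : ∀ i → PA.emb i (PA.hy0 i) ≡ PA.y0 i
  emb-hy0 i = PA.emb-emb⁻¹ i (PA.y0 i) (PA.y0≢x i) (PA.y0≢y i)
  emb-hy1 : ∀ i → PA.emb i (PA.hy1 i) ≡ PA.y1 i
  emb-hy1 i = PA.emb-emb⁻¹ i (PA.y1 i) (PA.y1≢x i) (PA.y1≢y i)

  hv-emb-cong : ∀ i j (h : Fin (PA.m i)) (w : Fin (2 + PA.m i)) → PA.emb i h ≡ w → PA.emb i j ≡ w
    → hv {K} {P} i h ≡ hv i j
  hv-emb-cong i j h w e1 e2 = cong (hv i) (PA.emb-injective i h j (trans e1 (sym e2)))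

  a-claimed-once : ∀ i t → not (atY⁰ (stateIn i t) ∧ atX⁰ (stateIn (nextPiece i) t)) ≡ true
  a-claimed-once i t = CompatibleFacts.a-claimed-once (junction-facts i t)
  b-claimed-once : ∀ i t → not (atY¹ (stateIn i t) ∧ atX¹ (stateIn (nextPiece i) t)) ≡ true
  b-claimed-once i t = CompatibleFacts.b-claimed-once (junction-facts i t)
  a-or-b-claimed : ∀ i t → not
    (aFree (stateIn i t) (stateIn (nextPiece i) t) ∧ bFree (stateIn i t) (stateIn (nextPiece i) t))
    ≡ true
  a-or-b-claimed i t = CompatibleFacts.a-or-b-claimed (junction-facts i t)
  spine-iff-both-claimed : ∀ i t →
    (not (aFree (stateIn i t) (stateIn (nextPiece i) t)) ∧ not
    (bFree (stateIn i t) (stateIn (nextPiece i) t))) ≡ spineTakes t (toℕ i)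
  spine-iff-both-claimed i t = CompatibleFacts.spine-iff-both-claimed (junction-facts i t)

  involutive-hx : ∀ t i j (e : mateIn t i j ≡ PA.x i) → AtXSide i (pick i t) j → partner t
    (partnerH i j (mateIn t i j) (PA.isX e)) ≡ hv i j
  involutive-hx t i j e (inj₁ (r , m)) = trans
    (cong (partner t) (partnerH-x0 i j (mateIn t i j) (PA.isX e) e r))
                         (trans (partner-a t (prevPiece i) false true bf af)
                         (trans (hv-hx0-cong (nextPiece-prevPiece i))
                           (hv-emb-cong i j (PA.hx0 i) (PA.x0 i) (emb-hx0 i) r)))
    where
    af : atX⁰ (stateIn (nextPiece (prevPiece i)) t) ≡ true
    af = trans (cong (λ z → atX⁰ (stateIn z t)) (nextPiece-prevPiece i)) (M⇒atX⁰ i t m)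
    bf : atY⁰ (stateIn (prevPiece i) t) ≡ false
    bf = nand-elimʳ (a-claimed-once (prevPiece i) t) af
  involutive-hx t i j e (inj₂ (r , m)) = trans
    (cong (partner t) (partnerH-x1 i j (mateIn t i j) (PA.isX e) e r))
                         (trans (partner-b t (prevPiece i) false true bf af)
                         (trans (hv-hx1-cong (nextPiece-prevPiece i))
                           (hv-emb-cong i j (PA.hx1 i) (PA.x1 i) (emb-hx1 i) r)))
    where
    af : atX¹ (stateIn (nextPiece (prevPiece i)) t) ≡ true
    af = trans (cong (λ z → atX¹ (stateIn z t)) (nextPiece-prevPiece i)) (M⇒atX¹ i t m)
    bf : atY¹ (stateIn (prevPiece i) t) ≡ false
    bf = nand-elimʳ (b-claimed-once (prevPiece i) t) af

  involutive-hy : ∀ t i j (e : mateIn t i j ≡ PA.y i) → AtYSide i (pick i t) j → partner t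
    (partnerH i j (mateIn t i j) (PA.isY e)) ≡ hv i j
  involutive-hy t i j e (inj₁ (r , m)) = trans
    (cong (partner t) (partnerH-y0 i j (mateIn t i j) (PA.isY e) e r))
                         (trans (partner-a t i true (atX⁰ (stateIn (nextPiece i) t))
                           (M⇒atY⁰ i t m) refl)
                           (hv-emb-cong i j (PA.hy0 i) (PA.y0 i) (emb-hy0 i) r))
  involutive-hy t i j e (inj₂ (r , m)) = trans
    (cong (partner t) (partnerH-y1 i j (mateIn t i j) (PA.isY e) e r))
                         (trans (partner-b t i true (atX¹ (stateIn (nextPiece i) t))
                           (M⇒atY¹ i t m) refl)
                           (hv-emb-cong i j (PA.hy1 i) (PA.y1 i) (emb-hy1 i) r))

  involutive-h : ∀ t i j (v : PA.View i (mateIn t i j)) → partner t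
    (partnerH i j (mateIn t i j) v) ≡ hv i j
  involutive-h t i j (PA.isH j' e) = partner-h-h t i j' j q
    where
    q : mateIn t i j' ≡ PA.emb i j
    q = mate-of i (pick i t) (PA.emb i j) (PA.emb i j')
      (subst (λ v → PA.M i (pick i t) (PA.emb i j) v ≡ true) (sym e)
      (PA.M-mate i (pick i t) (PA.emb i j)))
  involutive-h t i j (PA.isX e) = involutive-hx t i j e (mate-at-x i (pick i t) j e)
  involutive-h t i j (PA.isY e) = involutive-hy t i j e (mate-at-y i (pick i t) j e)

  involutive-a : ∀ t i b1 → atY⁰ (stateIn i t) ≡ b1 → ∀ b2 → atX⁰ (stateIn (nextPiece i) t) ≡ b2
    → partner t (partner t (av i)) ≡ av i
  involutive-a t i true e1 b2 e2 = trans (cong (partner t) (partner-a t i true b2 e1 e2))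
    (partner-h-y0 t i (PA.hy0 i) q (emb-hy0 i))
    where
    q : mateIn t i (PA.hy0 i) ≡ PA.y i
    q = mate-of i (pick i t) (PA.y i) (PA.emb i (PA.hy0 i))
      (subst (λ v → PA.M i (pick i t) (PA.y i) v ≡ true) (sym (emb-hy0 i)) (atY⁰⇒M i t e1))
  involutive-a t i false e1 true e2 = trans (cong (partner t) (partner-a t i false true e1 e2))
                                (trans (partner-h-x0 t (nextPiece i) (PA.hx0 (nextPiece i)) q
                                  (emb-hx0 (nextPiece i))) (cong av (prevPiece-nextPiece i)))
    where
    q : mateIn t (nextPiece i) (PA.hx0 (nextPiece i)) ≡ PA.x (nextPiece i)
    q = mate-of (nextPiece i) (pick (nextPiece i) t) (PA.x (nextPiece i)) _
      (subst (λ v → PA.M (nextPiece i) (pick (nextPiece i) t) (PA.x (nextPiece i)) v ≡ true)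
      (sym (emb-hx0 (nextPiece i))) (atX⁰⇒M (nextPiece i) t e2))
  involutive-a t i false e1 false e2 = trans (cong (partner t) (partner-a t i false false e1 e2))
                                 (partner-c t i true (bFree (stateIn i t) (stateIn (nextPiece i) t))
                                   (nor-intro e1 e2) refl)

  involutive-b : ∀ t i b1 → atY¹ (stateIn i t) ≡ b1 → ∀ b2 → atX¹ (stateIn (nextPiece i) t) ≡ b2
    → partner t (partner t (bv i)) ≡ bv i
  involutive-b t i true e1 b2 e2 = trans (cong (partner t) (partner-b t i true b2 e1 e2))
    (partner-h-y1 t i (PA.hy1 i) q (emb-hy1 i))
    where
    q : mateIn t i (PA.hy1 i) ≡ PA.y i
    q = mate-of i (pick i t) (PA.y i) (PA.emb i (PA.hy1 i))
      (subst (λ v → PA.M i (pick i t) (PA.y i) v ≡ true) (sym (emb-hy1 i)) (atY¹⇒M i t e1))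
  involutive-b t i false e1 true e2 = trans (cong (partner t) (partner-b t i false true e1 e2))
                                (trans (partner-h-x1 t (nextPiece i) (PA.hx1 (nextPiece i)) q
                                  (emb-hx1 (nextPiece i))) (cong bv (prevPiece-nextPiece i)))
    where
    q : mateIn t (nextPiece i) (PA.hx1 (nextPiece i)) ≡ PA.x (nextPiece i)
    q = mate-of (nextPiece i) (pick (nextPiece i) t) (PA.x (nextPiece i)) _
      (subst (λ v → PA.M (nextPiece i) (pick (nextPiece i) t) (PA.x (nextPiece i)) v ≡ true)
      (sym (emb-hx1 (nextPiece i))) (atX¹⇒M (nextPiece i) t e2))
  involutive-b t i false e1 false e2 = trans (cong (partner t) (partner-b t i false false e1 e2))
                                 (partner-c t i false true
                                   (nand-elimʳ (a-or-b-claimed i t) bfr) bfr)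
    where
    bfr : bFree (stateIn i t) (stateIn (nextPiece i) t) ≡ true
    bfr = nor-intro e1 e2

  involutive-c : ∀ t i b1 → aFree (stateIn i t) (stateIn (nextPiece i) t) ≡ b1 → ∀ b2 → bFree
    (stateIn i t) (stateIn (nextPiece i) t) ≡ b2 → partner t (partner t (cv i)) ≡ cv i
  involutive-c t i true e1 b2 e2 = trans (cong (partner t) (partner-c t i true b2 e1 e2))
    (partner-a t i false false (nor-elimˡ e1) (nor-elimʳ e1))
  involutive-c t i false e1 true e2 = trans (cong (partner t) (partner-c t i false true e1 e2))
    (partner-b t i false false (nor-elimˡ e2) (nor-elimʳ e2))
  involutive-c t i false e1 false e2 = trans (cong (partner t) (partner-c t i false false e1 e2))
    (vMate-cMate t i (neither⇒true (spine-iff-both-claimed i t) e1 e2))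

  involutive-v : ∀ t j → VMateCase t j → partner t (partner t (vv j)) ≡ vv j
  involutive-v t j (viaC i e1 e2 e3) = trans (cong (partner t) e1)
    (trans (partner-c t i false false (proj₁ ab) (proj₂ ab)) (cong vv e3))
    where
    ab = neither-elim (trans (spine-iff-both-claimed i t) e2)
  involutive-v t j (viaV j' e1 e2) = trans (cong (partner t) e1) e2

  partner-involutive : ∀ t u → partner t (partner t u) ≡ u
  partner-involutive t (hv i j) = involutive-h t i j (PA.view i (mateIn t i j))
  partner-involutive t (av i) = involutive-a t i _ refl _ refl
  partner-involutive t (bv i) = involutive-b t i _ refl _ refl
  partner-involutive t (cv i) = involutive-c t i _ refl _ refl
  partner-involutive t (vv j) = involutive-v t j (vMate-cases t j)

  E-hv : ∀ i j j' → E (hv i j) (hv i j') ≡ PA.G i (PA.emb i j) (PA.emb i j')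
  E-hv i j j' with i ≟ i
  ... | yes refl = refl
  ... | no ne = ⊥-elim (ne refl)

  isNext-prevPiece : ∀ i → isNext (prevPiece i) i ≡ true
  isNext-prevPiece i = subst (λ z → isNext (prevPiece i) z ≡ true) (nextPiece-prevPiece i)
    (isNext-nextPiece (prevPiece i))

  adj-x0-a : ∀ i j → PA.emb i j ≡ PA.x0 i → adjV (hv i j) (av (prevPiece i)) ≡ true
  adj-x0-a i j r = ∨-introʳ _ (∧-intro (isNext-prevPiece i) (==F-complete r))
  adj-x1-b : ∀ i j → PA.emb i j ≡ PA.x1 i → adjV (hv i j) (bv (prevPiece i)) ≡ true
  adj-x1-b i j r = ∨-introʳ _ (∧-intro (isNext-prevPiece i) (==F-complete r))
  adj-y0-a : ∀ i j → PA.emb i j ≡ PA.y0 i → adjV (hv i j) (av i) ≡ true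
  adj-y0-a i j r = ∨-introˡ (∧-intro (==F-refl i) (==F-complete r))
  adj-y1-b : ∀ i j → PA.emb i j ≡ PA.y1 i → adjV (hv i j) (bv i) ≡ true
  adj-y1-b i j r = ∨-introˡ (∧-intro (==F-refl i) (==F-complete r))

  adjacent-hx : ∀ t i j (e : mateIn t i j ≡ PA.x i) → AtXSide i (pick i t) j → adjV (hv i j)
    (partnerH i j (mateIn t i j) (PA.isX e)) ≡ true
  adjacent-hx t i j e (inj₁ (r , m)) = adj-along (partnerH-x0 i j (mateIn t i j) (PA.isX e) e r)
    (adj-x0-a i j r)
  adjacent-hx t i j e (inj₂ (r , m)) = adj-along (partnerH-x1 i j (mateIn t i j) (PA.isX e) e r)
    (adj-x1-b i j r)

  adjacent-hy : ∀ t i j (e : mateIn t i j ≡ PA.y i) → AtYSide i (pick i t) j → adjV (hv i j)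
    (partnerH i j (mateIn t i j) (PA.isY e)) ≡ true
  adjacent-hy t i j e (inj₁ (r , m)) = adj-along (partnerH-y0 i j (mateIn t i j) (PA.isY e) e r)
    (adj-y0-a i j r)
  adjacent-hy t i j e (inj₂ (r , m)) = adj-along (partnerH-y1 i j (mateIn t i j) (PA.isY e) e r)
    (adj-y1-b i j r)

  adjacent-hh : ∀ t i j j' (e : PA.emb i j' ≡ mateIn t i j) → adjV (hv i j) (hv i j') ≡ true
  adjacent-hh t i j j' e = ∨-introˡ {E (hv i j) (hv i j')} {E (hv i j') (hv i j)}
    (trans (E-hv i j j')
    (PA.M⊆G i (pick i t) (PA.emb i j) (PA.emb i j')
      (subst (λ v → PA.M i (pick i t) (PA.emb i j) v ≡ true) (sym e)
      (PA.M-mate i (pick i t) (PA.emb i j)))))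

  adjacent-h : ∀ t i j (v : PA.View i (mateIn t i j)) → adjV (hv i j)
    (partnerH i j (mateIn t i j) v) ≡ true
  adjacent-h t i j (PA.isH j' e) = adjacent-hh t i j j' e
  adjacent-h t i j (PA.isX e) = adjacent-hx t i j e (mate-at-x i (pick i t) j e)
  adjacent-h t i j (PA.isY e) = adjacent-hy t i j e (mate-at-y i (pick i t) j e)

  adj-a-hy0 : ∀ i → adjV (av i) (hv i (PA.hy0 i)) ≡ true
  adj-a-hy0 i = ∨-introˡ {E (av i) (hv i (PA.hy0 i))} {E (hv i (PA.hy0 i)) (av i)}
                (∨-introˡ {⌊ i ≟ i ⌋ ∧ ⌊ PA.emb i (PA.hy0 i) ≟ PA.y0 i ⌋}
                  (∧-intro (==F-refl i) (==F-complete (emb-hy0 i))))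
  adj-a-hx0 : ∀ i → adjV (av i) (hv (nextPiece i) (PA.hx0 (nextPiece i))) ≡ true
  adj-a-hx0 i = ∨-introˡ {E (av i) (hv (nextPiece i) (PA.hx0 (nextPiece i)))}
    {E (hv (nextPiece i) (PA.hx0 (nextPiece i))) (av i)}
                (∨-introʳ (⌊ i ≟ nextPiece i ⌋ ∧ ⌊ PA.emb (nextPiece i)
                  (PA.hx0 (nextPiece i)) ≟ PA.y0 (nextPiece i) ⌋)
                     (∧-intro (isNext-nextPiece i) (==F-complete (emb-hx0 (nextPiece i)))))
  adj-a-c : ∀ i → adjV (av i) (cv i) ≡ true
  adj-a-c i = ∨-introˡ {E (av i) (cv i)} {E (cv i) (av i)} (==F-refl i)
  adj-b-hy1 : ∀ i → adjV (bv i) (hv i (PA.hy1 i)) ≡ true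
  adj-b-hy1 i = ∨-introˡ {E (bv i) (hv i (PA.hy1 i))} {E (hv i (PA.hy1 i)) (bv i)}
                (∨-introˡ {⌊ i ≟ i ⌋ ∧ ⌊ PA.emb i (PA.hy1 i) ≟ PA.y1 i ⌋}
                  (∧-intro (==F-refl i) (==F-complete (emb-hy1 i))))
  adj-b-hx1 : ∀ i → adjV (bv i) (hv (nextPiece i) (PA.hx1 (nextPiece i))) ≡ true
  adj-b-hx1 i = ∨-introˡ {E (bv i) (hv (nextPiece i) (PA.hx1 (nextPiece i)))}
    {E (hv (nextPiece i) (PA.hx1 (nextPiece i))) (bv i)}
                (∨-introʳ (⌊ i ≟ nextPiece i ⌋ ∧ ⌊ PA.emb (nextPiece i)
                  (PA.hx1 (nextPiece i)) ≟ PA.y1 (nextPiece i) ⌋)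
                     (∧-intro (isNext-nextPiece i) (==F-complete (emb-hx1 (nextPiece i)))))
  adj-b-c : ∀ i → adjV (bv i) (cv i) ≡ true
  adj-b-c i = ∨-introˡ {E (bv i) (cv i)} {E (cv i) (bv i)} (==F-refl i)
  adj-c-a : ∀ i → adjV (cv i) (av i) ≡ true
  adj-c-a i = ==F-refl i
  adj-c-b : ∀ i → adjV (cv i) (bv i) ≡ true
  adj-c-b i = ==F-refl i

  adjacent-a : ∀ t i b1 → atY⁰ (stateIn i t) ≡ b1 → ∀ b2 → atX⁰ (stateIn (nextPiece i) t) ≡ b2
    → adjV (av i) (partner t (av i)) ≡ true
  adjacent-a t i true e1 b2 e2 = adj-along (partner-a t i true b2 e1 e2) (adj-a-hy0 i)
  adjacent-a t i false e1 true e2 = adj-along (partner-a t i false true e1 e2) (adj-a-hx0 i)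
  adjacent-a t i false e1 false e2 = adj-along (partner-a t i false false e1 e2) (adj-a-c i)

  adjacent-b : ∀ t i b1 → atY¹ (stateIn i t) ≡ b1 → ∀ b2 → atX¹ (stateIn (nextPiece i) t) ≡ b2
    → adjV (bv i) (partner t (bv i)) ≡ true
  adjacent-b t i true e1 b2 e2 = adj-along (partner-b t i true b2 e1 e2) (adj-b-hy1 i)
  adjacent-b t i false e1 true e2 = adj-along (partner-b t i false true e1 e2) (adj-b-hx1 i)
  adjacent-b t i false e1 false e2 = adj-along (partner-b t i false false e1 e2) (adj-b-c i)

  adjacent-c : ∀ t i b1 → aFree (stateIn i t) (stateIn (nextPiece i) t) ≡ b1 → ∀ b2 → bFree
    (stateIn i t) (stateIn (nextPiece i) t) ≡ b2 → adjV (cv i) (partner t (cv i)) ≡ true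
  adjacent-c t i true e1 b2 e2 = adj-along (partner-c t i true b2 e1 e2) (adj-c-a i)
  adjacent-c t i false e1 true e2 = adj-along (partner-c t i false true e1 e2) (adj-c-b i)
  adjacent-c t i false e1 false e2 = adj-along (partner-c t i false false e1 e2)
    (adj-cMate t i (neither⇒true (spine-iff-both-claimed i t) e1 e2))

  partner-adjacent : ∀ t u → adjV u (partner t u) ≡ true
  partner-adjacent t (hv i j) = adjacent-h t i j (PA.view i (mateIn t i j))
  partner-adjacent t (av i) = adjacent-a t i (atY⁰ (stateIn i t)) refl
    (atX⁰ (stateIn (nextPiece i) t)) refl
  partner-adjacent t (bv i) = adjacent-b t i (atY¹ (stateIn i t)) refl
    (atX¹ (stateIn (nextPiece i) t)) refl
  partner-adjacent t (cv i) = adjacent-c t i (aFree (stateIn i t) (stateIn (nextPiece i) t)) refl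
    (bFree (stateIn i t) (stateIn (nextPiece i) t)) refl
  partner-adjacent t (vv j) = adj-vMate t j

  partner-sym : ∀ t u v → (partner t u ==ᵛ v) ≡ (partner t v ==ᵛ u)
  partner-sym t = involution-==ᵛ-sym (partner t) (partner-involutive t)

  countB-pick : ∀ i (f : Fin 6 → Bool) → countB (λ t → f (pick i t)) ≡ countB f
  countB-pick i f = countB-∘-bijection (pick i) (pick⁻¹ i) (pick⁻¹-pick i) (pick-pick⁻¹ i) f

  atX⁰-twice : ∀ i → countB (λ t → atX⁰ (stateIn i t)) ≡ 2
  atX¹-twice : ∀ i → countB (λ t → atX¹ (stateIn i t)) ≡ 2
  atY⁰-twice : ∀ i → countB (λ t → atY⁰ (stateIn i t)) ≡ 2
  atY¹-twice : ∀ i → countB (λ t → atY¹ (stateIn i t)) ≡ 2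
  atX⁰-twice i = trans (countB-pick i (atX⁰ ∘ PA.state i))
    (proj₁ (proj₂ (proj₂ (PA.balanced-states i))))
  atX¹-twice i = trans (countB-pick i (atX¹ ∘ PA.state i)) (proj₁ (proj₂ (PA.balanced-states i)))
  atY⁰-twice i = trans (countB-pick i (atY⁰ ∘ PA.state i))
    (proj₂ (proj₂ (proj₂ (proj₂ (PA.balanced-states i)))))
  atY¹-twice i = trans (countB-pick i (atY¹ ∘ PA.state i))
    (proj₁ (proj₂ (proj₂ (proj₂ (PA.balanced-states i)))))

  ==ᵛ-hv-≢ : ∀ i i' j j' → ¬ i ≡ i' → _==ᵛ_ {K} {P} (hv i j) (hv i' j') ≡ false
  ==ᵛ-hv-≢ i i' j j' ne = ==ᵛ-false _ _ (λ e → ne (hv-injectiveˡ e))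

  partnerH-==ᵛ-hv : ∀ t i j j' (v : PA.View i (mateIn t i j)) →
    (partnerH i j (mateIn t i j) v ==ᵛ hv i j') ≡ ⌊ PA.emb i j' ≟ mateIn t i j ⌋
  partnerH-==ᵛ-hv t i j j' (PA.isH j'' e) = trans (==ᵛ-hv i j'' j')
    (⌊⌋-⇔ (j'' ≟ j') (PA.emb i j' ≟ mateIn t i j)
    (λ q → trans (cong (PA.emb i) (sym q)) e)
      (λ q → sym (PA.emb-injective i j' j'' (trans q (sym e)))))
  partnerH-==ᵛ-hv t i j j' (PA.isX e) = trans (pX-hv ⌊ PA.emb i j ≟ PA.x0 i ⌋)
    (sym (==F-false _ _ (λ z → PA.emb≢x i j' (trans z e))))
    where
    pX-hv : ∀ b → (partnerAtX i b ==ᵛ hv i j') ≡ false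
    pX-hv true = refl
    pX-hv false = refl
  partnerH-==ᵛ-hv t i j j' (PA.isY e) = trans (pY-hv ⌊ PA.emb i j ≟ PA.y0 i ⌋)
    (sym (==F-false _ _ (λ z → PA.emb≢y i j' (trans z e))))
    where
    pY-hv : ∀ b → (partnerAtY i b ==ᵛ hv i j') ≡ false
    pY-hv true = refl
    pY-hv false = refl

  count-h-h : ∀ i j j' → PA.G i (PA.emb i j) (PA.emb i j') ≡ true → countB
    (λ t → partner t (hv i j) ==ᵛ hv i j') ≡ 2
  count-h-h i j j' g = trans
    (countB-cong (λ t → trans (partnerH-==ᵛ-hv t i j j' (PA.view i (mateIn t i j)))
                                              (sym (PA.M≡mate i (pick i t) (PA.emb i j)
                                                (PA.emb i j')))))
                   (trans (countB-pick i (λ s → PA.M i s (PA.emb i j) (PA.emb i j')))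
                     (PA.covers-twice i _ _ g))

  ∨-resolve-∧ : ∀ X {n Y} → n ≡ false → (X ∨ (n ∧ Y)) ≡ true → X ≡ true
  ∨-resolve-∧ true _ _ = refl
  ∨-resolve-∧ false refl ()

  4+c≡6⇒c≡2 : ∀ c → 4 + c ≡ 6 → c ≡ 2
  4+c≡6⇒c≡2 c e = suc-injective (suc-injective (suc-injective (suc-injective e)))

  count-a-next : ∀ i j → PA.emb (nextPiece i) j ≡ PA.x0 (nextPiece i) → countB
    (λ t → partner t (av i) ==ᵛ hv (nextPiece i) j) ≡ 2
  count-a-next i j ex = trans (countB-cong (λ t → eqA2 t _ refl _ refl)) (atX⁰-twice (nextPiece i))
    where
    eqA2 : ∀ t b1 → atY⁰ (stateIn i t) ≡ b1 → ∀ b2 → atX⁰ (stateIn (nextPiece i) t) ≡ b2 →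
      (partner t (av i) ==ᵛ hv (nextPiece i) j) ≡ atX⁰ (stateIn (nextPiece i) t)
    eqA2 t true e1 b2 e2 = trans (cong (_==ᵛ hv (nextPiece i) j) (partner-a t i true b2 e1 e2))
      (trans (==ᵛ-hv-≢ i (nextPiece i) _ j (λ q → nextPiece≢ i (sym q)))
        (sym (nand-elimˡ (a-claimed-once i t) e1)))
    eqA2 t false e1 true e2 = trans
      (cong (_==ᵛ hv (nextPiece i) j) (partner-a t i false true e1 e2))
      (trans (==ᵛ-hv (nextPiece i) (PA.hx0 (nextPiece i)) j)
        (trans (==F-complete
        (PA.emb-injective (nextPiece i) _ _ (trans (emb-hx0 (nextPiece i)) (sym ex)))) (sym e2)))
    eqA2 t false e1 false e2 = trans
      (cong (_==ᵛ hv (nextPiece i) j) (partner-a t i false false e1 e2)) (sym e2)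

  count-a-h′ : ∀ i i' j (d : Dec (i ≡ i')) →
    ((⌊ d ⌋ ∧ ⌊ PA.emb i' j ≟ PA.y0 i' ⌋) ∨ (isNext i i' ∧ ⌊ PA.emb i' j ≟ PA.x0 i' ⌋)) ≡ true →
    countB (λ t → partner t (av i) ==ᵛ hv i' j) ≡ 2
  count-a-h′ i .i j (yes refl) e = trans (countB-cong (λ t → eqA t _ refl _ refl)) (atY⁰-twice i)
    where
    ey : PA.emb i j ≡ PA.y0 i
    ey = ==F-sound (PA.emb i j) (PA.y0 i) (∨-resolve-∧ _ (isNext-irrefl i) e)
    eqA : ∀ t b1 → atY⁰ (stateIn i t) ≡ b1 → ∀ b2 → atX⁰ (stateIn (nextPiece i) t) ≡ b2 →
      (partner t (av i) ==ᵛ hv i j) ≡ atY⁰ (stateIn i t)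
    eqA t true e1 b2 e2 = trans (cong (_==ᵛ hv i j) (partner-a t i true b2 e1 e2))
      (trans (==ᵛ-hv i (PA.hy0 i) j)
        (trans (==F-complete (PA.emb-injective i (PA.hy0 i) j (trans (emb-hy0 i) (sym ey))))
        (sym e1)))
    eqA t false e1 true e2 = trans (cong (_==ᵛ hv i j) (partner-a t i false true e1 e2))
      (trans (==ᵛ-hv-≢ (nextPiece i) i _ j (nextPiece≢ i)) (sym e1))
    eqA t false e1 false e2 = trans (cong (_==ᵛ hv i j) (partner-a t i false false e1 e2)) (sym e1)
  count-a-h′ i i' j (no ne) e = subst Mot (sym nx) (count-a-next i) j ex
    where
    Mot : Fin K → Set
    Mot z = (j : Fin (PA.m z)) → PA.emb z j ≡ PA.x0 z → countB
      (λ t → partner t (av i) ==ᵛ hv z j) ≡ 2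
    nx : i' ≡ nextPiece i
    nx = isNext⇒nextPiece i i' (∧-conicalˡ _ _ e)
    ex : PA.emb i' j ≡ PA.x0 i'
    ex = ==F-sound (PA.emb i' j) (PA.x0 i') (∧-conicalʳ (isNext i i') _ e)

  count-a-h : ∀ i i' j →
    ((⌊ i ≟ i' ⌋ ∧ ⌊ PA.emb i' j ≟ PA.y0 i' ⌋) ∨ (isNext i i' ∧ ⌊ PA.emb i' j ≟ PA.x0 i' ⌋)) ≡ true →
    countB (λ t → partner t (av i) ==ᵛ hv i' j) ≡ 2
  count-a-h i i' j e = count-a-h′ i i' j (i ≟ i') e

  count-b-next : ∀ i j → PA.emb (nextPiece i) j ≡ PA.x1 (nextPiece i) → countB
    (λ t → partner t (bv i) ==ᵛ hv (nextPiece i) j) ≡ 2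
  count-b-next i j ex = trans (countB-cong (λ t → eqB2 t _ refl _ refl)) (atX¹-twice (nextPiece i))
    where
    eqB2 : ∀ t b1 → atY¹ (stateIn i t) ≡ b1 → ∀ b2 → atX¹ (stateIn (nextPiece i) t) ≡ b2 →
      (partner t (bv i) ==ᵛ hv (nextPiece i) j) ≡ atX¹ (stateIn (nextPiece i) t)
    eqB2 t true e1 b2 e2 = trans (cong (_==ᵛ hv (nextPiece i) j) (partner-b t i true b2 e1 e2))
      (trans (==ᵛ-hv-≢ i (nextPiece i) _ j (λ q → nextPiece≢ i (sym q)))
        (sym (nand-elimˡ (b-claimed-once i t) e1)))
    eqB2 t false e1 true e2 = trans
      (cong (_==ᵛ hv (nextPiece i) j) (partner-b t i false true e1 e2))
      (trans (==ᵛ-hv (nextPiece i) (PA.hx1 (nextPiece i)) j)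
        (trans (==F-complete
        (PA.emb-injective (nextPiece i) _ _ (trans (emb-hx1 (nextPiece i)) (sym ex)))) (sym e2)))
    eqB2 t false e1 false e2 = trans
      (cong (_==ᵛ hv (nextPiece i) j) (partner-b t i false false e1 e2)) (sym e2)

  count-b-h′ : ∀ i i' j (d : Dec (i ≡ i')) →
    ((⌊ d ⌋ ∧ ⌊ PA.emb i' j ≟ PA.y1 i' ⌋) ∨ (isNext i i' ∧ ⌊ PA.emb i' j ≟ PA.x1 i' ⌋)) ≡ true →
    countB (λ t → partner t (bv i) ==ᵛ hv i' j) ≡ 2
  count-b-h′ i .i j (yes refl) e = trans (countB-cong (λ t → eqBb t _ refl _ refl)) (atY¹-twice i)
    where
    ey : PA.emb i j ≡ PA.y1 i
    ey = ==F-sound (PA.emb i j) (PA.y1 i) (∨-resolve-∧ _ (isNext-irrefl i) e)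
    eqBb : ∀ t b1 → atY¹ (stateIn i t) ≡ b1 → ∀ b2 → atX¹ (stateIn (nextPiece i) t) ≡ b2 →
      (partner t (bv i) ==ᵛ hv i j) ≡ atY¹ (stateIn i t)
    eqBb t true e1 b2 e2 = trans (cong (_==ᵛ hv i j) (partner-b t i true b2 e1 e2))
      (trans (==ᵛ-hv i (PA.hy1 i) j)
        (trans (==F-complete (PA.emb-injective i (PA.hy1 i) j (trans (emb-hy1 i) (sym ey))))
        (sym e1)))
    eqBb t false e1 true e2 = trans (cong (_==ᵛ hv i j) (partner-b t i false true e1 e2))
      (trans (==ᵛ-hv-≢ (nextPiece i) i _ j (nextPiece≢ i)) (sym e1))
    eqBb t false e1 false e2 = trans (cong (_==ᵛ hv i j) (partner-b t i false false e1 e2)) (sym e1)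
  count-b-h′ i i' j (no ne) e = subst Mot (sym nx) (count-b-next i) j ex
    where
    Mot : Fin K → Set
    Mot z = (j : Fin (PA.m z)) → PA.emb z j ≡ PA.x1 z → countB
      (λ t → partner t (bv i) ==ᵛ hv z j) ≡ 2
    nx : i' ≡ nextPiece i
    nx = isNext⇒nextPiece i i' (∧-conicalˡ _ _ e)
    ex : PA.emb i' j ≡ PA.x1 i'
    ex = ==F-sound (PA.emb i' j) (PA.x1 i') (∧-conicalʳ (isNext i i') _ e)

  count-b-h : ∀ i i' j →
    ((⌊ i ≟ i' ⌋ ∧ ⌊ PA.emb i' j ≟ PA.y1 i' ⌋) ∨ (isNext i i' ∧ ⌊ PA.emb i' j ≟ PA.x1 i' ⌋)) ≡ true →
    countB (λ t → partner t (bv i) ==ᵛ hv i' j) ≡ 2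
  count-b-h i i' j e = count-b-h′ i i' j (i ≟ i') e

  count-a-c : ∀ i → countB (λ t → partner t (av i) ==ᵛ cv i) ≡ 2
  count-a-c i = trans (countB-cong (λ t → eqAC t _ refl _ refl))
              (4+c≡6⇒c≡2 _ (trans (cong (_+ countB (λ t → not (g t))) (sym c-or))
                (countB-complement g)))
    where
    g : Fin 6 → Bool
    g t = atY⁰ (stateIn i t) ∨ atX⁰ (stateIn (nextPiece i) t)
    c-or : countB g ≡ 4
    c-or = trans (countB-∨-disjoint (λ t → atY⁰ (stateIn i t))
      (λ t → atX⁰ (stateIn (nextPiece i) t)) (λ t → not-true (a-claimed-once i t)))
                 (cong₂ _+_ (atY⁰-twice i) (atX⁰-twice (nextPiece i)))
    eqAC : ∀ t b1 → atY⁰ (stateIn i t) ≡ b1 → ∀ b2 → atX⁰ (stateIn (nextPiece i) t) ≡ b2 →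
      (partner t (av i) ==ᵛ cv i) ≡ not (g t)
    eqAC t true e1 b2 e2 = trans (cong (_==ᵛ cv i) (partner-a t i true b2 e1 e2))
      (sym (nor-falseˡ _ e1))
    eqAC t false e1 true e2 = trans (cong (_==ᵛ cv i) (partner-a t i false true e1 e2))
      (sym (nor-falseʳ _ e2))
    eqAC t false e1 false e2 = trans (cong (_==ᵛ cv i) (partner-a t i false false e1 e2))
      (trans (==F-refl i) (sym (nor-intro e1 e2)))

  count-b-c : ∀ i → countB (λ t → partner t (bv i) ==ᵛ cv i) ≡ 2
  count-b-c i = trans (countB-cong (λ t → eqBC t _ refl _ refl))
              (4+c≡6⇒c≡2 _ (trans (cong (_+ countB (λ t → not (g t))) (sym c-or))
                (countB-complement g)))
    where
    g : Fin 6 → Bool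
    g t = atY¹ (stateIn i t) ∨ atX¹ (stateIn (nextPiece i) t)
    c-or : countB g ≡ 4
    c-or = trans (countB-∨-disjoint (λ t → atY¹ (stateIn i t))
      (λ t → atX¹ (stateIn (nextPiece i) t)) (λ t → not-true (b-claimed-once i t)))
                 (cong₂ _+_ (atY¹-twice i) (atX¹-twice (nextPiece i)))
    eqBC : ∀ t b1 → atY¹ (stateIn i t) ≡ b1 → ∀ b2 → atX¹ (stateIn (nextPiece i) t) ≡ b2 →
      (partner t (bv i) ==ᵛ cv i) ≡ not (g t)
    eqBC t true e1 b2 e2 = trans (cong (_==ᵛ cv i) (partner-b t i true b2 e1 e2))
      (sym (nor-falseˡ _ e1))
    eqBC t false e1 true e2 = trans (cong (_==ᵛ cv i) (partner-b t i false true e1 e2))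
      (sym (nor-falseʳ _ e2))
    eqBC t false e1 false e2 = trans (cong (_==ᵛ cv i) (partner-b t i false false e1 e2))
      (trans (==F-refl i) (sym (nor-intro e1 e2)))

  count-c-v : ∀ i j → E (cv i) (vv j) ≡ true → countB (λ t → partner t (cv i) ==ᵛ vv j) ≡ 2
  count-c-v i j e = trans (countB-cong (λ t → eqCV t _ refl _ refl)) (count-cMate i j e)
    where
    X : Fin 6 → Bool
    X t = _==ᵛ_ {K} {P} (vv (cMate t i)) (vv j)
    eqCV : ∀ t b1 → aFree (stateIn i t) (stateIn (nextPiece i) t) ≡ b1 → ∀ b2 → bFree (stateIn i t)
      (stateIn (nextPiece i) t) ≡ b2 →
      (partner t (cv i) ==ᵛ vv j) ≡ (spineTakes t (toℕ i) ∧ X t)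
    eqCV t true e1 b2 e2 = trans (cong (_==ᵛ vv j) (partner-c t i true b2 e1 e2))
      (sym (cong (λ z → z ∧ X t) (neither-falseˡ (spine-iff-both-claimed i t) e1)))
    eqCV t false e1 true e2 = trans (cong (_==ᵛ vv j) (partner-c t i false true e1 e2))
      (sym (cong (λ z → z ∧ X t) (neither-falseʳ (spine-iff-both-claimed i t) e2)))
    eqCV t false e1 false e2 = trans (cong (_==ᵛ vv j) (partner-c t i false false e1 e2))
      (sym (cong (λ z → z ∧ X t) (neither⇒true (spine-iff-both-claimed i t) e1 e2)))

  data SameH (i : Fin K) (j : Fin (PA.m i)) : (i' : Fin K) → Fin (PA.m i') → Set where
    sameH : ∀ j' → PA.G i (PA.emb i j) (PA.emb i j') ≡ true → SameH i j i j'

  E-hv-cases : ∀ i j i' j' → E (hv i j) (hv i' j') ≡ true → SameH i j i' j'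
  E-hv-cases i j i' j' e with i ≟ i'
  ... | yes refl = sameH j' e

  count-sameH : ∀ {i j i' j'} → SameH i j i' j' → countB
    (λ t → partner t (hv i j) ==ᵛ hv i' j') ≡ 2
  count-sameH {i} {j} (sameH j' g) = count-h-h i j j' g

  count-edge : ∀ u v → E u v ≡ true → countB (λ t → partner t u ==ᵛ v) ≡ 2
  count-edge (hv i j) (hv i' j') e = count-sameH (E-hv-cases i j i' j' e)
  count-edge (hv i j) (av _) ()
  count-edge (hv i j) (bv _) ()
  count-edge (hv i j) (cv _) ()
  count-edge (hv i j) (vv _) ()
  count-edge (av i) (hv i' j) e = count-a-h i i' j e
  count-edge (av i) (av _) ()
  count-edge (av i) (bv _) ()
  count-edge (av i) (cv i') e = subst (λ z → countB (λ t → partner t (av i) ==ᵛ cv z) ≡ 2)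
    (==F-sound i i' e) (count-a-c i)
  count-edge (av i) (vv _) ()
  count-edge (bv i) (hv i' j) e = count-b-h i i' j e
  count-edge (bv i) (av _) ()
  count-edge (bv i) (bv _) ()
  count-edge (bv i) (cv i') e = subst (λ z → countB (λ t → partner t (bv i) ==ᵛ cv z) ≡ 2)
    (==F-sound i i' e) (count-b-c i)
  count-edge (bv i) (vv _) ()
  count-edge (cv i) (hv _ _) ()
  count-edge (cv i) (av _) ()
  count-edge (cv i) (bv _) ()
  count-edge (cv i) (cv _) ()
  count-edge (cv i) (vv j) e = count-c-v i j e
  count-edge (vv j) (hv _ _) ()
  count-edge (vv j) (av _) ()
  count-edge (vv j) (bv _) ()
  count-edge (vv j) (cv _) ()
  count-edge (vv j) (vv j') e = count-vMate j j' e

  covered-twice : ∀ u v → adjV u v ≡ true → countB (λ t → partner t u ==ᵛ v) ≡ 2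
  covered-twice u v e = go (E u v) refl e
    where
    go : ∀ b → E u v ≡ b → (b ∨ E v u) ≡ true → countB (λ t → partner t u ==ᵛ v) ≡ 2
    go true eu _ = count-edge u v eu
    go false _ evu = trans (countB-cong (λ t → partner-sym t u v)) (count-edge v u evu)


module FromPartners (k : ℕ) (P : Fin k → Piece) where
  open Construction k P
  open Encoding k P

  perfectMatching : (p : Vtx k P → Vtx k P) → (∀ u → p (p u) ≡ u) → (∀ u → adjV u (p u) ≡ true) →
    PerfectMatching (MGraph k P)
  perfectMatching p involutive adjacent = record
    { M       = M
    ; sym     = λ a b → involution-==ᵛ-sym p involutive (decode a) (decode b)
    ; sub     = λ a b e → subst (λ z → adjV (decode a) z ≡ true)
                            (==ᵛ-sound (p (decode a)) (decode b) e) (adjacent (decode a))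
    ; perfect = λ a → countB≡1-intro (M a) (encode (p (decode a)))
        (trans (cong (p (decode a) ==ᵛ_) (decode-encode (p (decode a)))) (==ᵛ-refl (p (decode a))))
        (λ v e → trans (sym (encode-decode v))
          (cong encode (sym (==ᵛ-sound (p (decode a)) (decode v) e))))
    }
    where
    M : Graph N
    M a b = p (decode a) ==ᵛ decode b

  fulkersonCover : (p : Fin 6 → Vtx k P → Vtx k P) → (∀ t u → p t (p t u) ≡ u) →
    (∀ t u → adjV u (p t u) ≡ true) → (∀ u v → adjV u v ≡ true → countB (λ t → p t u ==ᵛ v) ≡ 2) →
    FulkersonCover (MGraph k P)
  fulkersonCover p involutive adjacent twice =
    (λ t → perfectMatching (p t) (involutive t) (adjacent t)) , λ u v → twice (decode u) (decode v)

odd⇒isEven : ∀ n → (3 + n) % 2 ≡ 1 → isEven n ≡ true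
odd⇒isEven n odd =
  trans (sym (not-involutive (isEven n)))
    (not-injective (trans (isEven-%2 (3 + n)) (cong (_≡ᵇ 0) odd)))

theorem3p2 : (k : ℕ) → 3 ≤ k → k % 2 ≡ 1 →
    (P : Fin k → Piece) → (∀ i → ValidPiece (P i)) →
    FulkersonCover (MGraph k P)
theorem3p2 (suc zero)          (s≤s ())         _   _ _
theorem3p2 (suc (suc zero))    (s≤s (s≤s ()))   _   _ _
theorem3p2 (suc (suc (suc n))) _ odd P VP =
  FromPartners.fulkersonCover (3 + n) P partner partner-involutive partner-adjacent covered-twice
  where open Assembly n (odd⇒isEven n odd) P VP
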